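{- Let $\lambda\vdash m$, $n\ge1$, and $S$ a standard tableau of shape $\lambda$ with descent composition $\alpha=(\alpha_1,\dots,\alpha_s)$, $s\le n$. Let $S'$ be the standard tableau with $\operatorname{EVAC}(V^n_S)=V^n_{S'}$ (so $DesComp(S')=\overleftarrow{\alpha}=(\alpha_s,\dots,\alpha_1)$). Then $\operatorname{EVAC}$ sends the source $T_\alpha(S)$ of $B(T_\alpha)_n$ onto the sink of the dual subcomponent $B(T_{\overleftarrow{\alpha}})_n$ (induced on $V^n_{S'}$), and sends the sink of $B(T_\alpha)_n$ onto the source $T_{\overleftarrow{\alpha}}(S')$ of $B(T_{\overleftarrow{\alpha}})_n$.
   Context: Tableaux of shape $\lambda$: fillings of the Young diagram (English notation) by positive integers weakly increasing along rows, strictly increasing down columns; $SSYT(\lambda)_n$: those with entries $\le n$. Row reading word $rw(T)$: rows left to right, from bottom row to top row. Crystal operators on words over $\{1,\dots,n\}$, $1\le i\le n-1$: place ")" under each $i$ and "(" under each $i+1$, repeatedly delete a "(" immediately followed (among remaining symbols) by ")", leaving $)^{\varphi}(^{\varepsilon}$; $f_i$ changes the $i$ of the rightmost unmatched ")" into $i+1$ (undefined if $\varphi=0$). On tableaux: apply $f_i$ to $rw(T)$ and change the corresponding entry. $B(\lambda)_n$: directed graph on $SSYT(\lambda)_n$ with edge $T\to T'$ labelled $i$ when $f_i(T)=T'$. Standardization $std(T)$ of $T$ of weight $\gamma$: replace entries $1$ left to right by $1,\dots,\gamma_1$, entries $2$ left to right by $\gamma_1+1,\dots,\gamma_1+\gamma_2$,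 etc. Descent of a standard $S$ with $m$ cells: $i$ with $i+1$ in a strictly lower row than $i$; with descents $d_1<\dots<d_k$, $DesComp(S)=(d_1,d_2-d_1,\dots,m-d_k)$. $V^n_S=\{T\in SSYT(\lambda)_n: std(T)=S\}$; $B(T_\alpha)_n$ is the subgraph of $B(\lambda)_n$ induced on $V^n_S$; its source is $T_\alpha(S)$, obtained from $S$ by replacing entries $\alpha_1+\dots+\alpha_{r-1}+1,\dots,\alpha_1+\dots+\alpha_r$ by $r$, and its sink is its unique vertex with no outgoing edge inside $V^n_S$. Evacuation: $\operatorname{EVAC}(T)$ is obtained by rotating $T$ by $180^\circ$, replacing each entry $i$ by $n-i+1$, and rectifying the skew tableau by jeu de taquin. -}

module Defs where

open import Data.Nat using (ℕ; zero; suc; _+_; _∸_; _≤_; _<_; _≥_; _≤ᵇ_; _<ᵇ_; _≡ᵇ_)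
open import Data.Bool using (Bool; true; false; if_then_else_; _∧_; _∨_)
open import Data.List using (List; []; _∷_; length; map; concat; reverse; upTo; take; drop; _++_; replicate)
open import Data.Nat.ListAction using (sum)
open import Data.Bool.ListAction using (any)
open import Data.List.Relation.Unary.All using (All)
open import Data.List.Relation.Unary.Linked using (Linked)
open import Data.List.Relation.Binary.Permutation.Propositional using (_↭_)
open import Data.Maybe using (Maybe; just; nothing)
import Data.Maybe as M
open import Data.Product using (_×_; _,_)
open import Relation.Binary.PropositionalEquality using (_≡_)
open import Relation.Nullary using (¬_)

-- Tableaux (English notation) as lists of rows, top row first.
-- Rows / columns / positions are 0-indexed internally.

Tableau : Set
Tableau = List (List ℕ)

Word : Set
Word = List ℕ

nth : {A : Set} → List A → ℕ → Maybe A
nth [] _ = nothing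
nth (x ∷ _) zero = just x
nth (_ ∷ xs) (suc k) = nth xs k

entry : Tableau → ℕ → ℕ → Maybe ℕ
entry T r c with nth T r
... | nothing = nothing
... | just row = nth row c

updAt : {A : Set} → ℕ → (A → A) → List A → List A
updAt _ f [] = []
updAt zero f (x ∷ xs) = f x ∷ xs
updAt (suc k) f (x ∷ xs) = x ∷ updAt k f xs

setEntry : ℕ → ℕ → ℕ → Tableau → Tableau
setEntry r c v = updAt r (updAt c (λ _ → v))

shape : Tableau → List ℕ
shape = map length

size : Tableau → ℕ
size T = sum (shape T)

Partition : List ℕ → Set
Partition la = Linked _≥_ la × All (λ x → 0 < x) la

IsTableau : Tableau → Set
IsTableau T =
  Partition (shape T) ×
  (∀ r c x y → entry T r c ≡ just x → entry T r (suc c) ≡ just y → x ≤ y) ×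
  (∀ r c x y → entry T r c ≡ just x → entry T (suc r) c ≡ just y → x < y)

SSYT : ℕ → List ℕ → Tableau → Set
SSYT n la T = shape T ≡ la × IsTableau T ×
  (∀ r c x → entry T r c ≡ just x → 1 ≤ x × x ≤ n)

IsStandard : Tableau → Set
IsStandard S = IsTableau S × (concat S ↭ map suc (upTo (size S)))

rw : Tableau → Word
rw T = concat (reverse T)

-- bracket rule: scanning left to right, `opens` = number of unmatched "(" (letters i+1)
-- so far; returns the position of the rightmost unmatched ")" (letter i)
rmu : ℕ → ℕ → ℕ → Maybe ℕ → Word → Maybe ℕ
rmu i opens idx acc [] = acc
rmu i opens idx acc (x ∷ w) with x ≡ᵇ i | x ≡ᵇ suc i | opens
... | true  | _     | zero   = rmu i zero (suc idx) (just idx) w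
... | true  | _     | suc o  = rmu i o (suc idx) acc w
... | false | true  | o      = rmu i (suc o) (suc idx) acc w
... | false | false | o      = rmu i o (suc idx) acc w

fWord : ℕ → Word → Maybe Word
fWord i w = M.map (λ p → updAt p (λ _ → suc i) w) (rmu i 0 0 nothing w)

splitBy : List ℕ → Word → List (List ℕ)
splitBy [] w = []
splitBy (k ∷ ks) w = take k w ∷ splitBy ks (drop k w)

fTab : ℕ → Tableau → Maybe Tableau
fTab i T = M.map (λ w → reverse (splitBy (reverse (shape T)) w)) (fWord i (rw T))

rowCells : ℕ → ℕ → List ℕ → List (ℕ × ℕ × ℕ)
rowCells r c [] = []
rowCells r c (x ∷ xs) = (r , c , x) ∷ rowCells r (suc c) xs

cellsFrom : ℕ → Tableau → List (ℕ × ℕ × ℕ)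
cellsFrom r [] = []
cellsFrom r (row ∷ T) = rowCells r 0 row ++ cellsFrom (suc r) T

cells : Tableau → List (ℕ × ℕ × ℕ)
cells = cellsFrom 0

count : {A : Set} → (A → Bool) → List A → ℕ
count p [] = 0
count p (x ∷ xs) = if p x then suc (count p xs) else count p xs

stdVal : List (ℕ × ℕ × ℕ) → ℕ → ℕ → ℕ
stdVal cs c v = suc (count (λ { (_ , c' , v') → (v' <ᵇ v) ∨ ((v' ≡ᵇ v) ∧ (c' <ᵇ c)) }) cs)

stdRow : List (ℕ × ℕ × ℕ) → ℕ → List ℕ → List ℕ
stdRow cs c [] = []
stdRow cs c (x ∷ xs) = stdVal cs c x ∷ stdRow cs (suc c) xs

std : Tableau → Tableau
std T = map (stdRow (cells T) 0) T

rowOf : Tableau → ℕ → ℕ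
rowOf [] k = 0
rowOf (row ∷ T) k = if any (_≡ᵇ k) row then 0 else suc (rowOf T k)

filterB : {A : Set} → (A → Bool) → List A → List A
filterB p [] = []
filterB p (x ∷ xs) = if p x then x ∷ filterB p xs else filterB p xs

descents : Tableau → List ℕ
descents S = filterB (λ i → rowOf S i <ᵇ rowOf S (suc i)) (map suc (upTo (size S ∸ 1)))

diffs : ℕ → List ℕ → List ℕ
diffs prev [] = []
diffs prev (d ∷ ds) = (d ∸ prev) ∷ diffs d ds

desComp : Tableau → List ℕ
desComp S = diffs 0 (descents S ++ (size S ∷ []))

label : List ℕ → ℕ → ℕ
label [] v = 1
label (a ∷ α) v = if v ≤ᵇ a then 1 else suc (label α (v ∸ a))

Tα : List ℕ → Tableau → Tableau
Tα α S = map (map (label α)) S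

InV : ℕ → Tableau → Tableau → Set
InV n S T = SSYT n (shape S) T × std T ≡ S

IsSink : ℕ → Tableau → Tableau → Set
IsSink n S T = InV n S T ×
  (∀ i T' → 1 ≤ i → i < n → fTab i T ≡ just T' → ¬ InV n S T')

-- Evacuation: rotate by 180°, i ↦ n+1-i, rectify by jeu de taquin.
-- Skew tableaux: rows padded on the left with 0 for cells of the inner shape.

headLen : Tableau → ℕ
headLen [] = 0
headLen (row ∷ _) = length row

rotate : ℕ → Tableau → Tableau
rotate n T = map (λ row → replicate (headLen T ∸ length row) 0 ++ reverse (map (λ x → suc n ∸ x) row)) (reverse T)

leadZeros : List ℕ → ℕ
leadZeros [] = 0
leadZeros (zero ∷ xs) = suc (leadZeros xs)
leadZeros (suc _ ∷ xs) = 0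

lastInner : ℕ → Tableau → Maybe (ℕ × ℕ)
lastInner r [] = nothing
lastInner r (row ∷ T) with lastInner (suc r) T | leadZeros row
... | just p  | _     = just p
... | nothing | zero  = nothing
... | nothing | suc k = just (r , k)

slide : ℕ → Tableau → ℕ → ℕ → Tableau
slide zero T r c = T
slide (suc f) T r c with entry T r (suc c) | entry T (suc r) c
... | nothing | nothing = updAt r (take c) T
... | just x  | nothing = slide f (setEntry r c x T) r (suc c)
... | nothing | just y  = slide f (setEntry r c y T) (suc r) c
... | just x  | just y  = if y ≤ᵇ x then slide f (setEntry r c y T) (suc r) c
                                    else slide f (setEntry r c x T) r (suc c)

rectFuel : ℕ → Tableau → Tableau
rectFuel zero T = T
rectFuel (suc f) T with lastInner 0 T
... | nothing = T
... | just (r , c) = rectFuel f (slide (size T + length T) T r c)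

dropEmpty : Tableau → Tableau
dropEmpty [] = []
dropEmpty ([] ∷ T) = dropEmpty T
dropEmpty ((x ∷ xs) ∷ T) = (x ∷ xs) ∷ dropEmpty T

rectify : Tableau → Tableau
rectify T = dropEmpty (rectFuel (suc (size T)) T)

EVAC : ℕ → Tableau → Tableau
EVAC n T = rectify (rotate n T)

-- f_i turns one letter i into i+1, so it raises by one the number of entries in
-- [i+1, n]; evacuation only moves entries around apart from x ↦ n+1-x, so it
-- turns that number into the number of entries in [1, n-i].  Every T ∈ V_S
-- dominates the source T_α(S) entrywise and hence has at most as many entries
-- ≤ n-i; therefore no f_i-step from EVAC(T_α(S)) stays in V_{S'}, i.e. it is the
-- sink.  Dually the sink of V_S is T_α(S) shifted up by n - ℓ(α): an entry below
-- that bound, chosen with all larger standard values already at their bound, can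
-- be raised by an f_i-step without leaving V_S.  Evacuating the shifted source
-- gives a tableau of weight reverse α, and the only tableau of V_{S'} of weight β
-- is T_β(S').

module Submission where

open import Defs
open import Data.Bool using (Bool; true; false; _∧_; _∨_; if_then_else_)
open import Data.Bool.Properties using (∧-zeroʳ)
open import Data.Bool.ListAction using (any)
open import Data.Empty using (⊥; ⊥-elim)
open import Data.List using (List; []; _∷_; _++_; _∷ʳ_; concat; drop; length; map; replicate; reverse; take; upTo)
open import Data.List.Properties using (++-assoc; ++-identityʳ; concat-++; concat-map; length-++; length-drop; length-map; length-reverse; length-upTo; map-++; reverse-++; reverse-involutive; reverse-map; take++drop≡id; take-all; upTo-∷ʳ)
open import Data.List.Membership.Propositional using (_∈_)
open import Data.List.Membership.Propositional.Properties using (∈-++⁺ʳ; ∈-++⁺ˡ; ∈-++⁻; ∈-concat⁻′)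
open import Data.List.Relation.Binary.Permutation.Propositional using (_↭_)
import Data.List.Relation.Binary.Permutation.Propositional as P
open import Data.List.Relation.Binary.Permutation.Propositional.Properties using (↭-reverse)
open import Data.List.Relation.Unary.All using (All; []; _∷_)
import Data.List.Relation.Unary.All as All
import Data.List.Relation.Unary.All.Properties as AllP
open import Data.List.Relation.Unary.Any using (here; there)
open import Data.List.Relation.Unary.Any.Properties using (reverse⁻)
open import Data.List.Relation.Unary.Linked using (Linked; []; _∷_)
open import Data.Maybe using (Maybe; just; nothing)
import Data.Maybe as M
open import Data.Maybe.Properties using (just-injective)
open import Data.Nat
open import Data.Nat.ListAction using (sum)
open import Data.Nat.ListAction.Properties using (sum-↭)
open import Data.Nat.Properties
open import Data.Nat.Tactic.RingSolver using (solve-∀)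
open import Data.Product using (_×_; _,_; proj₁; proj₂; ∃; ∃₂)
open import Data.Sum using (_⊎_; inj₁; inj₂)
open import Data.Unit using (⊤; tt)
open import Relation.Binary using (tri<; tri≈; tri>)
open import Relation.Binary.PropositionalEquality
open import Relation.Nullary using (¬_; yes; no)

true≢false : true ≢ false
true≢false ()

bit : Bool → ℕ
bit true = 1
bit false = 0

count-cons : {A : Set} (p : A → Bool) (x : A) (xs : List A) → count p (x ∷ xs) ≡ bit (p x) + count p xs
count-cons p x xs with p x
... | true = refl
... | false = refl

count-++ : {A : Set} (p : A → Bool) (xs ys : List A) → count p (xs ++ ys) ≡ count p xs + count p ys
count-++ p [] ys = refl
count-++ p (x ∷ xs) ys with p x
... | true = cong suc (count-++ p xs ys)
... | false = count-++ p xs ys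

count-snoc : {A : Set} (p : A → Bool) (xs : List A) (x : A) → count p (xs ∷ʳ x) ≡ count p xs + bit (p x)
count-snoc p xs x = trans (count-++ p xs (x ∷ [])) (cong (count p xs +_) (trans (count-cons p x []) (+-identityʳ _)))

count-reverse : {A : Set} (p : A → Bool) (xs : List A) → count p (reverse xs) ≡ count p xs
count-reverse p [] = refl
count-reverse p (x ∷ xs) = begin
  count p (reverse (x ∷ xs)) ≡⟨ cong (count p) (reverse-++ (x ∷ []) xs) ⟩
  count p (reverse xs ∷ʳ x) ≡⟨ count-snoc p (reverse xs) x ⟩
  count p (reverse xs) + bit (p x) ≡⟨ cong (_+ bit (p x)) (count-reverse p xs) ⟩
  count p xs + bit (p x) ≡⟨ +-comm (count p xs) (bit (p x)) ⟩
  bit (p x) + count p xs ≡⟨ sym (count-cons p x xs) ⟩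
  count p (x ∷ xs) ∎
  where open ≡-Reasoning

count-map : {A B : Set} (p : B → Bool) (f : A → B) (xs : List A) → count p (map f xs) ≡ count (λ x → p (f x)) xs
count-map p f [] = refl
count-map p f (x ∷ xs) with p (f x)
... | true = cong suc (count-map p f xs)
... | false = count-map p f xs

count-ext∈ : {A : Set} (p q : A → Bool) (xs : List A) → (∀ x → x ∈ xs → p x ≡ q x) → count p xs ≡ count q xs
count-ext∈ p q [] h = refl
count-ext∈ p q (x ∷ xs) h = begin
  count p (x ∷ xs) ≡⟨ count-cons p x xs ⟩
  bit (p x) + count p xs ≡⟨ cong₂ (λ a b → bit a + b) (h x (here refl)) (count-ext∈ p q xs (λ y m → h y (there m))) ⟩
  bit (q x) + count q xs ≡⟨ sym (count-cons q x xs) ⟩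
  count q (x ∷ xs) ∎
  where open ≡-Reasoning

count-mono∈ : {A : Set} (p q : A → Bool) (xs : List A) → (∀ x → x ∈ xs → p x ≡ true → q x ≡ true) → count p xs ≤ count q xs
count-mono∈ p q [] h = z≤n
count-mono∈ p q (x ∷ xs) h with p x in eq | q x in eq'
... | true | true = s≤s (count-mono∈ p q xs (λ y m → h y (there m)))
... | true | false with h x (here refl) eq
...   | e = ⊥-elim (true≢false (trans (sym e) eq'))
count-mono∈ p q (x ∷ xs) h | false | true = m≤n⇒m≤1+n (count-mono∈ p q xs (λ y m → h y (there m)))
count-mono∈ p q (x ∷ xs) h | false | false = count-mono∈ p q xs (λ y m → h y (there m))

count-strict∈ : {A : Set} (p q : A → Bool) (xs : List A) → (∀ x → x ∈ xs → p x ≡ true → q x ≡ true) →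
  (w : A) → w ∈ xs → p w ≡ false → q w ≡ true → suc (count p xs) ≤ count q xs
count-strict∈ p q (x ∷ xs) h w (here refl) pw qw rewrite pw | qw = s≤s (count-mono∈ p q xs (λ y m → h y (there m)))
count-strict∈ p q (x ∷ xs) h w (there mem) pw qw with p x in eq | q x in eq'
... | true | true = s≤s (count-strict∈ p q xs (λ y m → h y (there m)) w mem pw qw)
... | true | false with h x (here refl) eq
...   | e = ⊥-elim (true≢false (trans (sym e) eq'))
count-strict∈ p q (x ∷ xs) h w (there mem) pw qw | false | true = ≤-trans (count-strict∈ p q xs (λ y m → h y (there m)) w mem pw qw) (n≤1+n _)
count-strict∈ p q (x ∷ xs) h w (there mem) pw qw | false | false = count-strict∈ p q xs (λ y m → h y (there m)) w mem pw qw

count-↭ : {A : Set} (p : A → Bool) {xs ys : List A} → xs ↭ ys → count p xs ≡ count p ys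
count-↭ p P.refl = refl
count-↭ p (P.prep {xs} {ys} x r) = trans (count-cons p x xs) (trans (cong (bit (p x) +_) (count-↭ p r)) (sym (count-cons p x ys)))
count-↭ p (P.swap {xs} {ys} x y r) = begin
  count p (x ∷ y ∷ xs) ≡⟨ count-cons p x (y ∷ xs) ⟩
  bit (p x) + count p (y ∷ xs) ≡⟨ cong (bit (p x) +_) (count-cons p y xs) ⟩
  bit (p x) + (bit (p y) + count p xs) ≡⟨ cong (λ z → bit (p x) + (bit (p y) + z)) (count-↭ p r) ⟩
  bit (p x) + (bit (p y) + count p ys) ≡⟨ sym (+-assoc (bit (p x)) (bit (p y)) (count p ys)) ⟩
  bit (p x) + bit (p y) + count p ys ≡⟨ cong (_+ count p ys) (+-comm (bit (p x)) (bit (p y))) ⟩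
  bit (p y) + bit (p x) + count p ys ≡⟨ +-assoc (bit (p y)) (bit (p x)) (count p ys) ⟩
  bit (p y) + (bit (p x) + count p ys) ≡⟨ cong (bit (p y) +_) (sym (count-cons p x ys)) ⟩
  bit (p y) + count p (x ∷ ys) ≡⟨ sym (count-cons p y (x ∷ ys)) ⟩
  count p (y ∷ x ∷ ys) ∎
  where open ≡-Reasoning
count-↭ p (P.trans r s) = trans (count-↭ p r) (count-↭ p s)

count-≤len : {A : Set} (p : A → Bool) (xs : List A) → count p xs ≤ length xs
count-≤len p [] = z≤n
count-≤len p (x ∷ xs) with p x
... | true = s≤s (count-≤len p xs)
... | false = m≤n⇒m≤1+n (count-≤len p xs)

count≥1⇒∈ : {A : Set} (p : A → Bool) (xs : List A) → 0 < count p xs → ∃ λ x → x ∈ xs × p x ≡ true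
count≥1⇒∈ p (x ∷ xs) h with p x in eq
... | true = x , here refl , eq
... | false with count≥1⇒∈ p xs h
...   | y , m , e = y , there m , e

count-false : {A : Set} (p : A → Bool) (xs : List A) → (∀ x → x ∈ xs → p x ≡ false) → count p xs ≡ 0
count-false p [] h = refl
count-false p (x ∷ xs) h rewrite h x (here refl) = count-false p xs (λ y m → h y (there m))

count-true : {A : Set} (p : A → Bool) (xs : List A) → (∀ x → x ∈ xs → p x ≡ true) → count p xs ≡ length xs
count-true p [] h = refl
count-true p (x ∷ xs) h rewrite h x (here refl) = cong suc (count-true p xs (λ y m → h y (there m)))

≡ᵇ-true⇒≡ : (m n : ℕ) → (m ≡ᵇ n) ≡ true → m ≡ n
≡ᵇ-true⇒≡ zero zero e = refl
≡ᵇ-true⇒≡ (suc m) (suc n) e = cong suc (≡ᵇ-true⇒≡ m n e)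
≡ᵇ-true⇒≡ zero (suc n) ()
≡ᵇ-true⇒≡ (suc m) zero ()

≡ᵇ-refl : (n : ℕ) → (n ≡ᵇ n) ≡ true
≡ᵇ-refl zero = refl
≡ᵇ-refl (suc n) = ≡ᵇ-refl n

≢⇒≡ᵇ-false : (m n : ℕ) → m ≢ n → (m ≡ᵇ n) ≡ false
≢⇒≡ᵇ-false m n ne with m ≡ᵇ n in e
... | true = ⊥-elim (ne (≡ᵇ-true⇒≡ m n e))
... | false = refl

<ᵇ-true⇒< : (m n : ℕ) → (m <ᵇ n) ≡ true → m < n
<ᵇ-true⇒< zero (suc n) e = s≤s z≤n
<ᵇ-true⇒< (suc m) (suc n) e = s≤s (<ᵇ-true⇒< m n e)
<ᵇ-true⇒< m zero ()

<⇒<ᵇ-true : (m n : ℕ) → m < n → (m <ᵇ n) ≡ true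
<⇒<ᵇ-true zero (suc n) h = refl
<⇒<ᵇ-true (suc m) (suc n) (s≤s h) = <⇒<ᵇ-true m n h

<ᵇ-false⇒≮ : (m n : ℕ) → (m <ᵇ n) ≡ false → ¬ (m < n)
<ᵇ-false⇒≮ m n e h with trans (sym e) (<⇒<ᵇ-true m n h)
... | ()

≮⇒<ᵇ-false : (m n : ℕ) → ¬ (m < n) → (m <ᵇ n) ≡ false
≮⇒<ᵇ-false m n h with m <ᵇ n in e
... | true = ⊥-elim (h (<ᵇ-true⇒< m n e))
... | false = refl

≤ᵇ-true⇒≤ : (m n : ℕ) → (m ≤ᵇ n) ≡ true → m ≤ n
≤ᵇ-true⇒≤ zero n e = z≤n
≤ᵇ-true⇒≤ (suc m) n e = <ᵇ-true⇒< m n e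

≤⇒≤ᵇ-true : (m n : ℕ) → m ≤ n → (m ≤ᵇ n) ≡ true
≤⇒≤ᵇ-true zero n h = refl
≤⇒≤ᵇ-true (suc m) n h = <⇒<ᵇ-true m n h

≤ᵇ-false⇒≰ : (m n : ℕ) → (m ≤ᵇ n) ≡ false → ¬ (m ≤ n)
≤ᵇ-false⇒≰ m n e h with trans (sym e) (≤⇒≤ᵇ-true m n h)
... | ()

≰⇒≤ᵇ-false : (m n : ℕ) → ¬ (m ≤ n) → (m ≤ᵇ n) ≡ false
≰⇒≤ᵇ-false m n h with m ≤ᵇ n in e
... | true = ⊥-elim (h (≤ᵇ-true⇒≤ m n e))
... | false = refl

∈⇒count≥1 : {A : Set} (q : A → Bool) (xs : List A) (w : A) → w ∈ xs → q w ≡ true → 1 ≤ count q xs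
∈⇒count≥1 q (x ∷ xs) w (here refl) qw rewrite qw = s≤s z≤n
∈⇒count≥1 q (x ∷ xs) w (there m) qw with q x
... | true = s≤s z≤n
... | false = ∈⇒count≥1 q xs w m qw

nth-map : {A B : Set} (f : A → B) (xs : List A) (k : ℕ) → nth (map f xs) k ≡ M.map f (nth xs k)
nth-map f [] k = refl
nth-map f (x ∷ xs) zero = refl
nth-map f (x ∷ xs) (suc k) = nth-map f xs k

nth-<len : {A : Set} (xs : List A) (k : ℕ) {x : A} → nth xs k ≡ just x → k < length xs
nth-<len (y ∷ xs) zero e = s≤s z≤n
nth-<len (y ∷ xs) (suc k) e = s≤s (nth-<len xs k e)

len-nth : {A : Set} (xs : List A) (k : ℕ) → k < length xs → ∃ λ x → nth xs k ≡ just x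
len-nth (y ∷ xs) zero h = y , refl
len-nth (y ∷ xs) (suc k) (s≤s h) = len-nth xs k h

nth-∈ : {A : Set} (xs : List A) (k : ℕ) {x : A} → nth xs k ≡ just x → x ∈ xs
nth-∈ (y ∷ xs) zero refl = here refl
nth-∈ (y ∷ xs) (suc k) e = there (nth-∈ xs k e)

∈-nth : {A : Set} (xs : List A) {x : A} → x ∈ xs → ∃ λ k → nth xs k ≡ just x
∈-nth (y ∷ xs) (here refl) = zero , refl
∈-nth (y ∷ xs) (there m) with ∈-nth xs m
... | k , e = suc k , e

nth-updAt-same : {A : Set} (g : A → A) (xs : List A) (k : ℕ) {x : A} → nth xs k ≡ just x → nth (updAt k g xs) k ≡ just (g x)
nth-updAt-same g (y ∷ xs) zero refl = refl
nth-updAt-same g (y ∷ xs) (suc k) e = nth-updAt-same g xs k e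

nth-updAt-other : {A : Set} (g : A → A) (xs : List A) (k k' : ℕ) → k ≢ k' → nth (updAt k g xs) k' ≡ nth xs k'
nth-updAt-other g [] k k' ne = refl
nth-updAt-other g (y ∷ xs) zero zero ne = ⊥-elim (ne refl)
nth-updAt-other g (y ∷ xs) zero (suc k') ne = refl
nth-updAt-other g (y ∷ xs) (suc k) zero ne = refl
nth-updAt-other g (y ∷ xs) (suc k) (suc k') ne = nth-updAt-other g xs k k' (λ e → ne (cong suc e))

length-updAt : {A : Set} (g : A → A) (xs : List A) (k : ℕ) → length (updAt k g xs) ≡ length xs
length-updAt g [] k = refl
length-updAt g (y ∷ xs) zero = refl
length-updAt g (y ∷ xs) (suc k) = cong suc (length-updAt g xs k)

map-updAt : {A B : Set} (f : A → B) (g : A → A) (xs : List A) (k : ℕ) → (∀ a → f (g a) ≡ f a) → map f (updAt k g xs) ≡ map f xs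
map-updAt f g [] k h = refl
map-updAt f g (y ∷ xs) zero h = cong (_∷ map f xs) (h y)
map-updAt f g (y ∷ xs) (suc k) h = cong (f y ∷_) (map-updAt f g xs k h)

entry-row : (T : Tableau) (r c : ℕ) {row : List ℕ} → nth T r ≡ just row → entry T r c ≡ nth row c
entry-row T r c e with nth T r
entry-row T r c refl | just row = refl

entry-nothing : (T : Tableau) (r c : ℕ) → nth T r ≡ nothing → entry T r c ≡ nothing
entry-nothing T r c e with nth T r
entry-nothing T r c refl | nothing = refl

entry-just : (T : Tableau) (r c : ℕ) {x : ℕ} → entry T r c ≡ just x → ∃ λ row → nth T r ≡ just row × nth row c ≡ just x
entry-just T r c e with nth T r
entry-just T r c e | just row = row , refl , e

entry-map : (f : ℕ → ℕ) (T : Tableau) (r c : ℕ) → entry (map (map f) T) r c ≡ M.map f (entry T r c)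
entry-map f T r c with nth T r in eq
... | nothing = entry-nothing (map (map f) T) r c (trans (nth-map (map f) T r) (cong (M.map (map f)) eq))
... | just row = trans (entry-row (map (map f) T) r c (trans (nth-map (map f) T r) (cong (M.map (map f)) eq))) (nth-map f row c)

shape-setEntry : (r c v : ℕ) (T : Tableau) → shape (setEntry r c v T) ≡ shape T
shape-setEntry r c v T = map-updAt length (updAt c (λ _ → v)) T r (λ row → length-updAt (λ _ → v) row c)

entry-setEntry-same : (r c v : ℕ) (T : Tableau) {x : ℕ} → entry T r c ≡ just x → entry (setEntry r c v T) r c ≡ just v
entry-setEntry-same r c v T e with entry-just T r c e
... | row , er , ec = trans (entry-row (setEntry r c v T) r c (nth-updAt-same (updAt c (λ _ → v)) T r er)) (nth-updAt-same (λ _ → v) row c ec)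

entry-setEntry-other : (r c v : ℕ) (T : Tableau) (r' c' : ℕ) → ¬ (r ≡ r' × c ≡ c') → entry (setEntry r c v T) r' c' ≡ entry T r' c'
entry-setEntry-other r c v T r' c' ne with r ≟ r'
... | no r≢r' with nth T r' in eq
...   | nothing = entry-nothing (setEntry r c v T) r' c' (trans (nth-updAt-other (updAt c (λ _ → v)) T r r' r≢r') eq)
...   | just row = entry-row (setEntry r c v T) r' c' (trans (nth-updAt-other (updAt c (λ _ → v)) T r r' r≢r') eq)
entry-setEntry-other r c v T .r c' ne | yes refl with nth T r in eq
... | nothing = entry-nothing (setEntry r c v T) r c' (lemma T r eq)
  where lemma : (T : Tableau) (r : ℕ) → nth T r ≡ nothing → nth (setEntry r c v T) r ≡ nothing
        lemma [] r e = refl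
        lemma (x ∷ T) zero ()
        lemma (x ∷ T) (suc r) e = lemma T r e
... | just row = trans (entry-row (setEntry r c v T) r c' (nth-updAt-same (updAt c (λ _ → v)) T r eq))
                       (nth-updAt-other (λ _ → v) row c c' (λ e → ne (refl , e)))

nth-ext : (X Y : List ℕ) → length X ≡ length Y → (∀ c x → nth X c ≡ just x → nth Y c ≡ just x) → X ≡ Y
nth-ext [] [] l h = refl
nth-ext (x ∷ X) (y ∷ Y) l h with h zero x refl
... | refl = cong (x ∷_) (nth-ext X Y (suc-injective l) (λ c z e → h (suc c) z e))

tab-ext : (X Y : Tableau) → shape X ≡ shape Y → (∀ r c x → entry X r c ≡ just x → entry Y r c ≡ just x) → X ≡ Y
tab-ext [] [] s h = refl
tab-ext (rx ∷ X) (ry ∷ Y) s h = cong₂ _∷_ (nth-ext rx ry (∷-inj₁ s) (λ c x e → h zero c x e)) (tab-ext X Y (∷-inj₂ s) (λ r c x e → h (suc r) c x e))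
  where
  ∷-inj₁ : {a b : ℕ} {as bs : List ℕ} → _≡_ {A = List ℕ} (a ∷ as) (b ∷ bs) → a ≡ b
  ∷-inj₁ refl = refl
  ∷-inj₂ : {a b : ℕ} {as bs : List ℕ} → _≡_ {A = List ℕ} (a ∷ as) (b ∷ bs) → as ≡ bs
  ∷-inj₂ refl = refl

nth-shape : {A : Set} (X Y : List (List A)) → map length X ≡ map length Y → (r : ℕ) {rx : List A} → nth X r ≡ just rx → ∃ λ ry → nth Y r ≡ just ry × length rx ≡ length ry
nth-shape (a ∷ X) (b ∷ Y) s zero refl = b , refl , cong-head s
  where cong-head : ∀ {p q : ℕ} {ps qs} → _≡_ {A = List ℕ} (p ∷ ps) (q ∷ qs) → p ≡ q
        cong-head refl = refl
nth-shape (a ∷ X) (b ∷ Y) s (suc r) e = nth-shape X Y (cong-tail s) r e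
  where cong-tail : ∀ {p q : ℕ} {ps qs} → _≡_ {A = List ℕ} (p ∷ ps) (q ∷ qs) → ps ≡ qs
        cong-tail refl = refl

shape-entry : (X Y : Tableau) → shape X ≡ shape Y → (r c : ℕ) {x : ℕ} → entry X r c ≡ just x → ∃ λ y → entry Y r c ≡ just y
shape-entry X Y s r c e with entry-just X r c e
... | rx , er , ec with nth-shape X Y s r er
...   | ry , er' , l with len-nth ry c (subst (c <_) l (nth-<len rx c ec))
...     | y , ey = y , trans (entry-row Y r c er') ey

Cell : Set
Cell = ℕ × ℕ × ℕ

rowE : Cell → ℕ
rowE (r , c , x) = r
colE : Cell → ℕ
colE (r , c , x) = c
valE : Cell → ℕ
valE (r , c , x) = x

rowCells-row : (r c : ℕ) (row : List ℕ) (e : Cell) → e ∈ rowCells r c row → rowE e ≡ r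
rowCells-row r c (x ∷ row) e (here refl) = refl
rowCells-row r c (x ∷ row) e (there m) = rowCells-row r (suc c) row e m

rowCells-mem : (r c : ℕ) (row : List ℕ) (e : Cell) → e ∈ rowCells r c row → ∃ λ k → colE e ≡ c + k × nth row k ≡ just (valE e)
rowCells-mem r c (x ∷ row) e (here refl) = 0 , sym (+-identityʳ c) , refl
rowCells-mem r c (x ∷ row) e (there m) with rowCells-mem r (suc c) row e m
... | k , ec , en = suc k , trans ec (sym (+-suc c k)) , en

cellsFrom-mem : (r : ℕ) (T : Tableau) (e : Cell) → e ∈ cellsFrom r T → ∃ λ k → rowE e ≡ r + k × entry T k (colE e) ≡ just (valE e)
cellsFrom-mem r (row ∷ T) e m with ∈-++⁻ (rowCells r 0 row) m
... | inj₁ m1 with rowCells-mem r 0 row e m1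
...   | k , ec , en = 0 , trans (rowCells-row r 0 row e m1) (sym (+-identityʳ r)) , subst (λ z → nth row z ≡ just (valE e)) (sym ec) en
cellsFrom-mem r (row ∷ T) e m | inj₂ m2 with cellsFrom-mem (suc r) T e m2
... | k , er , en = suc k , trans er (sym (+-suc r k)) , en

cellsFrom-row≥ : (r : ℕ) (T : Tableau) (e : Cell) → e ∈ cellsFrom r T → r ≤ rowE e
cellsFrom-row≥ r T e m with cellsFrom-mem r T e m
... | k , er , _ = subst (r ≤_) (sym er) (m≤m+n r k)

cells-mem : (T : Tableau) (r c x : ℕ) → (r , c , x) ∈ cells T → entry T r c ≡ just x
cells-mem T r c x m with cellsFrom-mem 0 T (r , c , x) m
... | k , refl , en = en

mem-rowCells : (r c : ℕ) (row : List ℕ) (k x : ℕ) → nth row k ≡ just x → (r , c + k , x) ∈ rowCells r c row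
mem-rowCells r c (y ∷ row) zero x refl rewrite +-identityʳ c = here refl
mem-rowCells r c (y ∷ row) (suc k) x e rewrite +-suc c k = there (mem-rowCells r (suc c) row k x e)

mem-cellsFrom : (r : ℕ) (T : Tableau) (k c x : ℕ) → entry T k c ≡ just x → (r + k , c , x) ∈ cellsFrom r T
mem-cellsFrom r (row ∷ T) zero c x e rewrite +-identityʳ r = ∈-++⁺ˡ (mem-rowCells r 0 row c x e)
mem-cellsFrom r (row ∷ T) (suc k) c x e rewrite +-suc r k = ∈-++⁺ʳ (rowCells r 0 row) (mem-cellsFrom (suc r) T k c x e)

mem-cells : (T : Tableau) (r c x : ℕ) → entry T r c ≡ just x → (r , c , x) ∈ cells T
mem-cells T r c x e = mem-cellsFrom 0 T r c x e

vals-rowCells : (r c : ℕ) (row : List ℕ) → map valE (rowCells r c row) ≡ row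
vals-rowCells r c [] = refl
vals-rowCells r c (x ∷ row) = cong (x ∷_) (vals-rowCells r (suc c) row)

vals-cellsFrom : (r : ℕ) (T : Tableau) → map valE (cellsFrom r T) ≡ concat T
vals-cellsFrom r [] = refl
vals-cellsFrom r (row ∷ T) = trans (map-++ valE (rowCells r 0 row) (cellsFrom (suc r) T)) (cong₂ _++_ (vals-rowCells r 0 row) (vals-cellsFrom (suc r) T))

count-cells : (g : ℕ → Bool) (T : Tableau) → count (λ e → g (valE e)) (cells T) ≡ count g (concat T)
count-cells g T = trans (sym (count-map g valE (cells T))) (cong (count g) (vals-cellsFrom 0 T))

OffPos : ℕ → ℕ → Cell → Set
OffPos r c e = ¬ (rowE e ≡ r × colE e ≡ c)

rowCells-split : (r c : ℕ) (row : List ℕ) (k x : ℕ) → nth row k ≡ just x →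
  ∃₂ λ A B → rowCells r c row ≡ A ++ (r , c + k , x) ∷ B ×
    (∀ y → rowCells r c (updAt k (λ _ → y) row) ≡ A ++ (r , c + k , y) ∷ B) ×
    (∀ e → e ∈ A ++ B → OffPos r (c + k) e)
rowCells-split r c (z ∷ row) zero x refl rewrite +-identityʳ c =
  [] , rowCells r (suc c) row , refl , (λ y → refl) , off
  where
  off : ∀ e → e ∈ rowCells r (suc c) row → OffPos r c e
  off e m (_ , ec) with rowCells-mem r (suc c) row e m
  ... | k , ec' , _ = m≢1+m+n c (trans (sym ec) ec')
rowCells-split r c (z ∷ row) (suc k) x e with rowCells-split r (suc c) row k x e
... | A , B , eq , eqy , off rewrite +-suc c k =
  (r , c , z) ∷ A , B , cong ((r , c , z) ∷_) eq , (λ y → cong ((r , c , z) ∷_) (eqy y)) , off'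
  where
  off' : ∀ e → e ∈ ((r , c , z) ∷ A) ++ B → OffPos r (suc (c + k)) e
  off' e (here refl) (_ , ec) = m≢1+m+n c ec
  off' e (there m) = off e m

cellsFrom-split : (r0 : ℕ) (T : Tableau) (k c x : ℕ) → entry T k c ≡ just x →
  ∃₂ λ A B → cellsFrom r0 T ≡ A ++ (r0 + k , c , x) ∷ B ×
    (∀ y → cellsFrom r0 (setEntry k c y T) ≡ A ++ (r0 + k , c , y) ∷ B) ×
    (∀ e → e ∈ A ++ B → OffPos (r0 + k) c e)
cellsFrom-split r0 (row ∷ T) zero c x e with rowCells-split r0 0 row c x e
... | A , B , eq , eqy , off rewrite +-identityʳ r0 =
  A , B ++ cellsFrom (suc r0) T ,
  trans (cong (_++ cellsFrom (suc r0) T) eq) (++-assoc A _ _) ,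
  (λ y → trans (cong (_++ cellsFrom (suc r0) T) (eqy y)) (++-assoc A _ _)) ,
  off'
  where
  off' : ∀ e → e ∈ A ++ B ++ cellsFrom (suc r0) T → OffPos r0 c e
  off' e m with ∈-++⁻ (A ++ B) (subst (e ∈_) (sym (++-assoc A B _)) m)
  ... | inj₁ m1 = off e m1
  ... | inj₂ m2 = λ { (er , _) → 1+n≰n (subst (suc r0 ≤_) er (cellsFrom-row≥ (suc r0) T e m2)) }
cellsFrom-split r0 (row ∷ T) (suc k) c x e with cellsFrom-split (suc r0) T k c x e
... | A , B , eq , eqy , off rewrite sym (+-suc r0 k) =
  rowCells r0 0 row ++ A , B ,
  trans (cong (rowCells r0 0 row ++_) eq) (sym (++-assoc (rowCells r0 0 row) A _)) ,
  (λ y → trans (cong (rowCells r0 0 row ++_) (eqy y)) (sym (++-assoc (rowCells r0 0 row) A _))) ,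
  off'
  where
  off' : ∀ e → e ∈ (rowCells r0 0 row ++ A) ++ B → OffPos (r0 + suc k) c e
  off' e m with ∈-++⁻ (rowCells r0 0 row) (subst (e ∈_) (++-assoc (rowCells r0 0 row) A B) m)
  ... | inj₂ m2 = off e m2
  ... | inj₁ m1 = λ { (er , _) → m≢1+m+n r0 (trans (sym (rowCells-row r0 0 row e m1)) (trans er (+-suc r0 k))) }

cells-split : (T : Tableau) (r c x : ℕ) → entry T r c ≡ just x →
  ∃₂ λ A B → cells T ≡ A ++ (r , c , x) ∷ B ×
    (∀ y → cells (setEntry r c y T) ≡ A ++ (r , c , y) ∷ B) ×
    (∀ e → e ∈ A ++ B → OffPos r c e)
cells-split T r c x e = cellsFrom-split 0 T r c x e

+-exchange : ∀ a b d e → a + (b + d) + e ≡ a + (e + d) + b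
+-exchange = solve-∀

count-setEntry : (p : Cell → Bool) (T : Tableau) (r c x y : ℕ) → entry T r c ≡ just x →
  count p (cells (setEntry r c y T)) + bit (p (r , c , x)) ≡ count p (cells T) + bit (p (r , c , y))
count-setEntry p T r c x y e with cells-split T r c x e
... | A , B , eq , eqy , off rewrite eq | eqy y
    | count-++ p A ((r , c , y) ∷ B) | count-++ p A ((r , c , x) ∷ B)
    | count-cons p (r , c , y) B | count-cons p (r , c , x) B =
  +-exchange (count p A) (bit (p (r , c , y))) (count p B) (bit (p (r , c , x)))

count-offpos : (p q : Cell → Bool) (T : Tableau) (r c x : ℕ) → entry T r c ≡ just x →
  (∀ e → e ∈ cells T → OffPos r c e → p e ≡ q e) →
  count p (cells T) + bit (q (r , c , x)) ≡ count q (cells T) + bit (p (r , c , x))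
count-offpos p q T r c x e h with cells-split T r c x e
... | A , B , eq , eqy , off rewrite eq
    | count-++ p A ((r , c , x) ∷ B) | count-++ q A ((r , c , x) ∷ B)
    | count-cons p (r , c , x) B | count-cons q (r , c , x) B =
  trans (cong (λ z → z + bit (q (r , c , x))) (cong₂ (λ a d → a + (bit (p (r , c , x)) + d)) hA hB))
        (+-exchange (count q A) (bit (p (r , c , x))) (count q B) (bit (q (r , c , x))))
  where
  hA : count p A ≡ count q A
  hA = count-ext∈ p q A (λ z m → h z (∈-++⁺ˡ m) (off z (∈-++⁺ˡ m)))
  hB : count p B ≡ count q B
  hB = count-ext∈ p q B (λ z m → h z (∈-++⁺ʳ A (there m)) (off z (∈-++⁺ʳ A m)))

linked-step : (L : List ℕ) → Linked _≥_ L → (r : ℕ) {b : ℕ} → nth L (suc r) ≡ just b → ∃ λ a → nth L r ≡ just a × b ≤ a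
linked-step (x ∷ y ∷ L) (h ∷ l) zero refl = x , refl , h
linked-step (x ∷ y ∷ L) (h ∷ l) (suc r) e = linked-step (y ∷ L) l r e

linked-up : (L : List ℕ) → Linked _≥_ L → (r k : ℕ) {b : ℕ} → nth L (r + k) ≡ just b → ∃ λ a → nth L r ≡ just a × b ≤ a
linked-up L l r zero e rewrite +-identityʳ r = _ , e , ≤-refl
linked-up L l r (suc k) e rewrite +-suc r k with linked-step L l (r + k) e
... | a , ea , ba with linked-up L l r k ea
...   | a' , ea' , aa' = a' , ea' , ≤-trans ba aa'

nth-map-just : {A B : Set} (f : A → B) (xs : List A) (k : ℕ) {b : B} → nth (map f xs) k ≡ just b → ∃ λ a → nth xs k ≡ just a × f a ≡ b
nth-map-just f (x ∷ xs) zero refl = x , refl , refl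
nth-map-just f (x ∷ xs) (suc k) e = nth-map-just f xs k e

module _ (T : Tableau) (tab : IsTableau T) where
  private
    lnk : Linked _≥_ (shape T)
    lnk = proj₁ (proj₁ tab)
    rowW : ∀ r c x y → entry T r c ≡ just x → entry T r (suc c) ≡ just y → x ≤ y
    rowW = proj₁ (proj₂ tab)
    colS : ∀ r c x y → entry T r c ≡ just x → entry T (suc r) c ≡ just y → x < y
    colS = proj₂ (proj₂ tab)

  entry-up : (r k c : ℕ) {y : ℕ} → entry T (r + k) c ≡ just y → ∃ λ z → entry T r c ≡ just z
  entry-up r k c e with entry-just T (r + k) c e
  ... | row' , er' , ec' with linked-up (shape T) lnk r k (trans (nth-map length T (r + k)) (cong (M.map length) er'))
  ...   | a , ea , la with nth-map-just length T r ea
  ...     | row , er , refl with len-nth row c (≤-trans (nth-<len row' c ec') la)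
  ...       | z , ez = z , trans (entry-row T r c er) ez

  entry-left : (r c k : ℕ) {y : ℕ} → entry T r (c + k) ≡ just y → ∃ λ z → entry T r c ≡ just z
  entry-left r c k e with entry-just T r (c + k) e
  ... | row , er , ec with len-nth row c (≤-trans (s≤s (m≤m+n c k)) (nth-<len row (c + k) ec))
  ...   | z , ez = z , trans (entry-row T r c er) ez

  row-mono : (r c k : ℕ) {x y : ℕ} → entry T r c ≡ just x → entry T r (c + k) ≡ just y → x ≤ y
  row-mono r c zero ex ey rewrite +-identityʳ c = ≤-reflexive (just-injective (trans (sym ex) ey))
  row-mono r c (suc k) {y = y} ex ey rewrite +-suc c k with entry-left r (c + k) 1 (subst (λ t → entry T r t ≡ just y) (sym (+-comm (c + k) 1)) ey)
  ... | z , ez = ≤-trans (row-mono r c k ex ez) (rowW r (c + k) z _ ez ey)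

  col-mono : (r k c : ℕ) {x y : ℕ} → entry T r c ≡ just x → entry T (r + suc k) c ≡ just y → x < y
  col-mono r zero c ex ey rewrite +-comm r 1 = colS r c _ _ ex ey
  col-mono r (suc k) c {y = y} ex ey rewrite +-suc r (suc k) with entry-up (r + suc k) 1 c (subst (λ t → entry T t c ≡ just y) (sym (+-comm (r + suc k) 1)) ey)
  ... | z , ez = <-trans (col-mono r k c ex ez) (colS (r + suc k) c z _ ez ey)

  row-mono' : (r c c' : ℕ) {x y : ℕ} → c ≤ c' → entry T r c ≡ just x → entry T r c' ≡ just y → x ≤ y
  row-mono' r c c' {y = y} le ex ey = row-mono r c (c' ∸ c) ex (subst (λ t → entry T r t ≡ just y) (sym (m+[n∸m]≡n le)) ey)

  col-mono' : (r r' c : ℕ) {x y : ℕ} → r < r' → entry T r c ≡ just x → entry T r' c ≡ just y → x < y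
  col-mono' r r' c {y = y} lt ex ey = col-mono r (r' ∸ suc r) c ex (subst (λ t → entry T t c ≡ just y) (sym eq) ey)
    where
    eq : r + suc (r' ∸ suc r) ≡ r'
    eq = trans (+-suc r (r' ∸ suc r)) (m+[n∸m]≡n lt)

  entry-up' : (r r' c : ℕ) {y : ℕ} → r ≤ r' → entry T r' c ≡ just y → ∃ λ z → entry T r c ≡ just z
  entry-up' r r' c {y} le e = entry-up r (r' ∸ r) c (subst (λ t → entry T t c ≡ just y) (sym (m+[n∸m]≡n le)) e)

  rect≤ : (r c r' c' : ℕ) {x y : ℕ} → r ≤ r' → c ≤ c' → entry T r c ≡ just x → entry T r' c' ≡ just y → x ≤ y
  rect≤ r c r' c' lr lc ex ey with entry-up' r r' c' lr ey
  ... | z , ez with m≤n⇒m<n∨m≡n lr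
  ...   | inj₁ lt = ≤-trans (row-mono' r c c' lc ex ez) (<⇒≤ (col-mono' r r' c' lt ez ey))
  ...   | inj₂ refl = row-mono' r c c' lc ex ey

  rect< : (r c r' c' : ℕ) {x y : ℕ} → r < r' → c ≤ c' → entry T r c ≡ just x → entry T r' c' ≡ just y → x < y
  rect< r c r' c' lr lc ex ey with entry-up' r r' c' (<⇒≤ lr) ey
  ... | z , ez = ≤-<-trans (row-mono' r c c' lc ex ez) (col-mono' r r' c' lr ez ey)

-- Entry counts under evacuation
countEntries : (ℕ → Bool) → Tableau → ℕ
countEntries P T = count P (concat T)

count-concat-cons : (P : ℕ → Bool) (x : List ℕ) (L : Tableau) → countEntries P (x ∷ L) ≡ count P x + countEntries P L
count-concat-cons P x L = count-++ P x (concat L)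

count-concat-reverse : (P : ℕ → Bool) (L : Tableau) → countEntries P (reverse L) ≡ countEntries P L
count-concat-reverse P [] = refl
count-concat-reverse P (x ∷ L) = begin
  count P (concat (reverse (x ∷ L))) ≡⟨ cong (λ z → count P (concat z)) (reverse-++ (x ∷ []) L) ⟩
  count P (concat (reverse L ++ (x ∷ []))) ≡⟨ cong (count P) (sym (concat-++ (reverse L) (x ∷ []))) ⟩
  count P (concat (reverse L) ++ (x ++ [])) ≡⟨ count-++ P (concat (reverse L)) (x ++ []) ⟩
  count P (concat (reverse L)) + count P (x ++ []) ≡⟨ cong₂ _+_ (count-concat-reverse P L) (cong (count P) (++-identityʳ x)) ⟩
  countEntries P L + count P x ≡⟨ +-comm (countEntries P L) (count P x) ⟩
  count P x + countEntries P L ≡⟨ sym (count-concat-cons P x L) ⟩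
  countEntries P (x ∷ L) ∎
  where open ≡-Reasoning

count-concat-map : (P Q : ℕ → Bool) (g : List ℕ → List ℕ) → (∀ row → count P (g row) ≡ count Q row) → (L : Tableau) → countEntries P (map g L) ≡ countEntries Q L
count-concat-map P Q g h [] = refl
count-concat-map P Q g h (x ∷ L) = trans (count-concat-cons P (g x) (map g L)) (trans (cong₂ _+_ (h x) (count-concat-map P Q g h L)) (sym (count-concat-cons Q x L)))

count-replicate0 : (P : ℕ → Bool) → P 0 ≡ false → (k : ℕ) → count P (replicate k 0) ≡ 0
count-replicate0 P p0 zero = refl
count-replicate0 P p0 (suc k) rewrite p0 = count-replicate0 P p0 k

countEntries-rotate : (P : ℕ → Bool) → P 0 ≡ false → (n : ℕ) (T : Tableau) → countEntries P (rotate n T) ≡ countEntries (λ x → P (suc n ∸ x)) T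
countEntries-rotate P p0 n T = trans (count-concat-map P (λ x → P (suc n ∸ x)) _ rowlem (reverse T)) (count-concat-reverse _ T)
  where
  rowlem : ∀ row → count P (replicate (headLen T ∸ length row) 0 ++ reverse (map (λ x → suc n ∸ x) row)) ≡ count (λ x → P (suc n ∸ x)) row
  rowlem row = trans (count-++ P (replicate (headLen T ∸ length row) 0) (reverse (map (λ x → suc n ∸ x) row))) (cong₂ _+_ (count-replicate0 P p0 (headLen T ∸ length row)) (trans (count-reverse P (map (λ x → suc n ∸ x) row)) (count-map P (λ x → suc n ∸ x) row)))

dropEmpty-concat : (T : Tableau) → concat (dropEmpty T) ≡ concat T
dropEmpty-concat [] = refl
dropEmpty-concat ([] ∷ T) = dropEmpty-concat T
dropEmpty-concat ((x ∷ xs) ∷ T) = cong (λ z → x ∷ xs ++ z) (dropEmpty-concat T)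

nth≤sum : (L : List ℕ) (r : ℕ) {a : ℕ} → nth L r ≡ just a → a ≤ sum L
nth≤sum (x ∷ L) zero refl = m≤m+n x (sum L)
nth≤sum (x ∷ L) (suc r) e = ≤-trans (nth≤sum L r e) (m≤n+m (sum L) x)

entry-bound : (T : Tableau) (r c : ℕ) {h : ℕ} → entry T r c ≡ just h → suc (r + c) ≤ length T + size T
entry-bound T r c e with entry-just T r c e
... | row , er , ec = +-mono-≤ (nth-<len T r er) (≤-trans (<⇒≤ (nth-<len row c ec)) (nth≤sum (shape T) r (trans (nth-map length T r) (cong (M.map length) er))))

take-count : (P : ℕ → Bool) (row : List ℕ) (c h : ℕ) → nth row c ≡ just h → nth row (suc c) ≡ nothing → count P (take c row) + bit (P h) ≡ count P row
take-count P (x ∷ []) zero h refl e2 = trans refl (sym (trans (count-cons P x []) (+-identityʳ _)))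
take-count P (x ∷ y ∷ row) zero h e1 ()
take-count P (x ∷ row) (suc c) h e1 e2 = trans (cong (_+ bit (P h)) (count-cons P x (take c row))) (trans (+-assoc (bit (P x)) _ _) (trans (cong (bit (P x) +_) (take-count P row c h e1 e2)) (sym (count-cons P x row))))

count-concat-updAt : (P : ℕ → Bool) (g : List ℕ → List ℕ) (T : Tableau) (r : ℕ) (row : List ℕ) (d : ℕ) → nth T r ≡ just row → count P (g row) + d ≡ count P row → countEntries P (updAt r g T) + d ≡ countEntries P T
count-concat-updAt P g (x ∷ T) zero row d refl h = begin
  count P (g x ++ concat T) + d ≡⟨ cong (_+ d) (count-++ P (g x) (concat T)) ⟩
  count P (g x) + countEntries P T + d ≡⟨ +-assoc (count P (g x)) _ d ⟩
  count P (g x) + (countEntries P T + d) ≡⟨ cong (count P (g x) +_) (+-comm (countEntries P T) d) ⟩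
  count P (g x) + (d + countEntries P T) ≡⟨ sym (+-assoc (count P (g x)) d _) ⟩
  count P (g x) + d + countEntries P T ≡⟨ cong (_+ countEntries P T) h ⟩
  count P x + countEntries P T ≡⟨ sym (count-++ P x (concat T)) ⟩
  countEntries P (x ∷ T) ∎
  where open ≡-Reasoning
count-concat-updAt P g (x ∷ T) (suc r) row d e h = begin
  count P (x ++ concat (updAt r g T)) + d ≡⟨ cong (_+ d) (count-++ P x _) ⟩
  count P x + countEntries P (updAt r g T) + d ≡⟨ +-assoc (count P x) _ d ⟩
  count P x + (countEntries P (updAt r g T) + d) ≡⟨ cong (count P x +_) (count-concat-updAt P g T r row d e h) ⟩
  count P x + countEntries P T ≡⟨ sym (count-++ P x (concat T)) ⟩
  countEntries P (x ∷ T) ∎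
  where open ≡-Reasoning

countEntries-setEntry : (P : ℕ → Bool) (T : Tableau) (r c x y : ℕ) → entry T r c ≡ just x → countEntries P (setEntry r c y T) + bit (P x) ≡ countEntries P T + bit (P y)
countEntries-setEntry P T r c x y e = subst₂ (λ a b → a + bit (P x) ≡ b + bit (P y)) (count-cells P (setEntry r c y T)) (count-cells P T) (count-setEntry (λ e → P (valE e)) T r c x y e)

length-setEntry : (r c v : ℕ) (T : Tableau) → length T ≡ length (setEntry r c v T)
length-setEntry r c v T = sym (length-updAt (updAt c (λ _ → v)) T r)

size-setEntry : (r c v : ℕ) (T : Tableau) → size T ≡ size (setEntry r c v T)
size-setEntry r c v T = cong sum (sym (shape-setEntry r c v T))

slide-step : (P : ℕ → Bool) (f : ℕ) (T : Tableau) (r c r' c' h x : ℕ) →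
  entry T r c ≡ just h → entry T r' c' ≡ just x → ¬ (r ≡ r' × c ≡ c') → r' + c' ≡ suc (r + c) →
  length T + size T ≤ suc f + (r + c) →
  (∀ T' → length T' + size T' ≤ f + (r' + c') → entry T' r' c' ≡ just x → countEntries P (slide f T' r' c') + bit (P x) ≡ countEntries P T') →
  countEntries P (slide f (setEntry r c x T) r' c') + bit (P h) ≡ countEntries P T
slide-step P f T r c r' c' h x eh ex ne sr bnd ih =
  +-cancelʳ-≡ (bit (P x)) _ _ (begin
    countEntries P (slide f T1 r' c') + bit (P h) + bit (P x) ≡⟨ +-assoc (countEntries P (slide f T1 r' c')) _ _ ⟩
    countEntries P (slide f T1 r' c') + (bit (P h) + bit (P x)) ≡⟨ cong (countEntries P (slide f T1 r' c') +_) (+-comm (bit (P h)) _) ⟩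
    countEntries P (slide f T1 r' c') + (bit (P x) + bit (P h)) ≡⟨ sym (+-assoc (countEntries P (slide f T1 r' c')) _ _) ⟩
    countEntries P (slide f T1 r' c') + bit (P x) + bit (P h) ≡⟨ cong (_+ bit (P h)) (ih T1 bnd' ex1) ⟩
    countEntries P T1 + bit (P h) ≡⟨ countEntries-setEntry P T r c h x eh ⟩
    countEntries P T + bit (P x) ∎)
  where
  open ≡-Reasoning
  T1 : Tableau
  T1 = setEntry r c x T
  ex1 : entry T1 r' c' ≡ just x
  ex1 = trans (entry-setEntry-other r c x T r' c' ne) ex
  bnd' : length T1 + size T1 ≤ f + (r' + c')
  bnd' = subst₂ (λ a b → a + b ≤ f + (r' + c')) (length-setEntry r c x T) (size-setEntry r c x T)
           (≤-trans bnd (≤-reflexive (trans (sym (+-suc f (r + c))) (cong (f +_) (sym sr)))))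

slide-count : (P : ℕ → Bool) (F : ℕ) (T : Tableau) (r c h : ℕ) → length T + size T ≤ F + (r + c) → entry T r c ≡ just h →
  countEntries P (slide F T r c) + bit (P h) ≡ countEntries P T
slide-count P zero T r c h bnd eh = ⊥-elim (1+n≰n (≤-trans (entry-bound T r c eh) bnd))
slide-count P (suc f) T r c h bnd eh with entry T r (suc c) in e1 | entry T (suc r) c in e2
... | nothing | nothing with entry-just T r c eh
...   | row , er , ec = count-concat-updAt P (take c) T r row (bit (P h)) er (take-count P row c h ec (trans (sym (entry-row T r (suc c) er)) e1))
slide-count P (suc f) T r c h bnd eh | just x | nothing =
  slide-step P f T r c r (suc c) h x eh e1 (λ { (_ , q) → 1+n≢n (sym q) }) (+-suc r c) bnd (λ T' b e → slide-count P f T' r (suc c) x b e)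
slide-count P (suc f) T r c h bnd eh | nothing | just y =
  slide-step P f T r c (suc r) c h y eh e2 (λ { (q , _) → 1+n≢n (sym q) }) refl bnd (λ T' b e → slide-count P f T' (suc r) c y b e)
slide-count P (suc f) T r c h bnd eh | just x | just y with y ≤ᵇ x
... | true = slide-step P f T r c (suc r) c h y eh e2 (λ { (q , _) → 1+n≢n (sym q) }) refl bnd (λ T' b e → slide-count P f T' (suc r) c y b e)
... | false = slide-step P f T r c r (suc c) h x eh e1 (λ { (_ , q) → 1+n≢n (sym q) }) (+-suc r c) bnd (λ T' b e → slide-count P f T' r (suc c) x b e)

leadZeros-nth : (row : List ℕ) (k : ℕ) → leadZeros row ≡ suc k → nth row k ≡ just 0
leadZeros-nth (zero ∷ row) zero e = refl
leadZeros-nth (zero ∷ row) (suc k) e = leadZeros-nth row k (suc-injective e)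

lastInner-spec : (r : ℕ) (T : Tableau) (r' c : ℕ) → lastInner r T ≡ just (r' , c) → ∃ λ k → r' ≡ r + k × entry T k c ≡ just 0
lastInner-spec r (row ∷ T) r' c e with lastInner (suc r) T in eq1 | leadZeros row in eq2
... | just p | _ with e
...   | refl with lastInner-spec (suc r) T r' c eq1
...     | k , refl , ek = suc k , sym (+-suc r k) , ek
lastInner-spec r (row ∷ T) r' c () | nothing | zero
lastInner-spec r (row ∷ T) r' c refl | nothing | suc k = 0 , sym (+-identityʳ r) , leadZeros-nth row k eq2

rectFuel-count : (P : ℕ → Bool) → P 0 ≡ false → (F : ℕ) (T : Tableau) → countEntries P (rectFuel F T) ≡ countEntries P T
rectFuel-count P p0 zero T = refl
rectFuel-count P p0 (suc f) T with lastInner 0 T in eq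
... | nothing = refl
... | just (r , c) with lastInner-spec 0 T r c eq
...   | k , refl , ek = trans (rectFuel-count P p0 f _)
          (trans (sym (+-identityʳ _)) (trans (cong (countEntries P (slide (size T + length T) T r c) +_) (cong bit (sym p0)))
            (slide-count P (size T + length T) T r c 0 (≤-trans (≤-reflexive (+-comm (length T) (size T))) (m≤m+n _ (r + c))) ek)))

-- Slides and rotation only move entries; the padding zeros are never counted.
countEntries-EVAC : (P : ℕ → Bool) → P 0 ≡ false → (n : ℕ) (T : Tableau) → countEntries P (EVAC n T) ≡ countEntries (λ x → P (suc n ∸ x)) T
countEntries-EVAC P p0 n T = trans (cong (count P) (dropEmpty-concat (rectFuel (suc (size (rotate n T))) (rotate n T)))) (trans (rectFuel-count P p0 (suc (size (rotate n T))) (rotate n T)) (countEntries-rotate P p0 n T))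

-- Crystal operators
rmu-spec : (i o idx : ℕ) (acc : Maybe ℕ) (w : Word) (p : ℕ) → rmu i o idx acc w ≡ just p → acc ≡ just p ⊎ ∃ λ k → p ≡ idx + k × nth w k ≡ just i
rmu-spec i o idx acc [] p e = inj₁ e
rmu-spec i o idx acc (x ∷ w) p e with x ≡ᵇ i in e1 | x ≡ᵇ suc i | o
... | true | _ | zero with rmu-spec i zero (suc idx) (just idx) w p e
...   | inj₁ refl = inj₂ (0 , sym (+-identityʳ idx) , cong just (≡ᵇ-true⇒≡ x i e1))
...   | inj₂ (k , ep , ek) = inj₂ (suc k , trans ep (sym (+-suc idx k)) , ek)
rmu-spec i o idx acc (x ∷ w) p e | true | _ | suc o' with rmu-spec i o' (suc idx) acc w p e
...   | inj₁ q = inj₁ q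
...   | inj₂ (k , ep , ek) = inj₂ (suc k , trans ep (sym (+-suc idx k)) , ek)
rmu-spec i o idx acc (x ∷ w) p e | false | true | o' with rmu-spec i (suc o') (suc idx) acc w p e
...   | inj₁ q = inj₁ q
...   | inj₂ (k , ep , ek) = inj₂ (suc k , trans ep (sym (+-suc idx k)) , ek)
rmu-spec i o idx acc (x ∷ w) p e | false | false | o' with rmu-spec i o' (suc idx) acc w p e
...   | inj₁ q = inj₁ q
...   | inj₂ (k , ep , ek) = inj₂ (suc k , trans ep (sym (+-suc idx k)) , ek)

fWord-spec : (i : ℕ) (w w' : Word) → fWord i w ≡ just w' → ∃ λ p → nth w p ≡ just i × w' ≡ updAt p (λ _ → suc i) w
fWord-spec i w w' e with rmu i 0 0 nothing w in eq
fWord-spec i w w' refl | just p with rmu-spec i 0 0 nothing w p eq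
... | inj₁ ()
... | inj₂ (k , refl , ek) = k , ek , refl

count-updAt : (P : ℕ → Bool) (w : List ℕ) (p x y : ℕ) → nth w p ≡ just x → count P (updAt p (λ _ → y) w) + bit (P x) ≡ count P w + bit (P y)
count-updAt P (z ∷ w) zero x y refl rewrite count-cons P y w | count-cons P z w = swap (bit (P y)) (count P w) (bit (P z))
  where
  swap : ∀ a b c → (a + b) + c ≡ (c + b) + a
  swap = solve-∀
count-updAt P (z ∷ w) (suc p) x y e rewrite count-cons P z (updAt p (λ _ → y) w) | count-cons P z w =
  trans (+-assoc (bit (P z)) _ _) (trans (cong (bit (P z) +_) (count-updAt P w p x y e)) (sym (+-assoc (bit (P z)) _ _)))

concat-splitBy : (ks : List ℕ) (w : Word) → length w ≤ sum ks → concat (splitBy ks w) ≡ w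
concat-splitBy [] [] h = refl
concat-splitBy [] (x ∷ w) ()
concat-splitBy (k ∷ ks) w h = trans (cong (take k w ++_) (concat-splitBy ks (drop k w) rest-fits)) (take++drop≡id k w)
  where
  open import Data.List.Properties using (take++drop≡id; length-drop)
  rest-fits : length (drop k w) ≤ sum ks
  rest-fits = subst (_≤ sum ks) (sym (length-drop k w)) (subst (_≤ sum ks) refl (∸-le (length w) k (sum ks) h))
    where
    ∸-le : ∀ a k s → a ≤ k + s → a ∸ k ≤ s
    ∸-le a zero s h = h
    ∸-le zero (suc k) s h = z≤n
    ∸-le (suc a) (suc k) s (s≤s h) = ∸-le a k s h

length-concat : (L : Tableau) → length (concat L) ≡ sum (map length L)
length-concat [] = refl
length-concat (x ∷ L) = trans (length-++ x) (cong (length x +_) (length-concat L))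

length-rw : (T : Tableau) → length (rw T) ≡ sum (reverse (shape T))
length-rw T = trans (length-concat (reverse T)) (cong sum (reverse-map length T))

countEntries-fTab : (P : ℕ → Bool) (i : ℕ) (E T' : Tableau) → fTab i E ≡ just T' → countEntries P T' + bit (P i) ≡ countEntries P E + bit (P (suc i))
countEntries-fTab P i E T' e with fWord i (rw E) in eq
countEntries-fTab P i E T' refl | just w' with fWord-spec i (rw E) w' eq
... | p , ep , refl = begin
  countEntries P (reverse (splitBy (reverse (shape E)) w')) + bit (P i) ≡⟨ cong (_+ bit (P i)) (count-concat-reverse P (splitBy (reverse (shape E)) w')) ⟩
  count P (concat (splitBy (reverse (shape E)) w')) + bit (P i) ≡⟨ cong (λ z → count P z + bit (P i)) (concat-splitBy (reverse (shape E)) w' lenle) ⟩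
  count P w' + bit (P i) ≡⟨ count-updAt P (rw E) p i (suc i) ep ⟩
  count P (rw E) + bit (P (suc i)) ≡⟨ cong (_+ bit (P (suc i))) (count-concat-reverse P E) ⟩
  countEntries P E + bit (P (suc i)) ∎
  where
  open ≡-Reasoning
  lenle : length w' ≤ sum (reverse (shape E))
  lenle = ≤-reflexive (trans (length-updAt (λ _ → suc i) (rw E) p) (length-rw E))

decomp : {A : Set} (xs : List A) (k : ℕ) {x : A} → nth xs k ≡ just x → xs ≡ take k xs ++ x ∷ drop (suc k) xs
decomp (y ∷ xs) zero refl = refl
decomp (y ∷ xs) (suc k) e = cong (y ∷_) (decomp xs k e)

decompU : {A : Set} (g : A → A) (xs : List A) (k : ℕ) {x : A} → nth xs k ≡ just x → updAt k g xs ≡ take k xs ++ g x ∷ drop (suc k) xs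
decompU g (y ∷ xs) zero refl = refl
decompU g (y ∷ xs) (suc k) e = cong (y ∷_) (decompU g xs k e)

∈-take : {A : Set} (xs : List A) (k : ℕ) {z : A} → z ∈ take k xs → ∃ λ k' → k' < k × nth xs k' ≡ just z
∈-take (y ∷ xs) (suc k) (here refl) = 0 , s≤s z≤n , refl
∈-take (y ∷ xs) (suc k) (there m) with ∈-take xs k m
... | k' , lt , e = suc k' , s≤s lt , e

∈-drop : {A : Set} (xs : List A) (k : ℕ) {z : A} → z ∈ drop (suc k) xs → ∃ λ k' → k < k' × nth xs k' ≡ just z
∈-drop (y ∷ xs) zero m with ∈-nth xs m
... | k' , e = suc k' , s≤s z≤n , e
∈-drop (y ∷ xs) (suc k) m with ∈-drop xs k m
... | k' , lt , e = suc k' , s≤s lt , e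

rw-split : (A : Tableau) (R : List ℕ) (B : Tableau) → rw (A ++ R ∷ B) ≡ concat (reverse B) ++ R ++ concat (reverse A)
rw-split A R B = begin
  concat (reverse (A ++ R ∷ B)) ≡⟨ cong concat (reverse-++ A (R ∷ B)) ⟩
  concat (reverse (R ∷ B) ++ reverse A) ≡⟨ sym (concat-++ (reverse (R ∷ B)) (reverse A)) ⟩
  concat (reverse (R ∷ B)) ++ concat (reverse A) ≡⟨ cong (λ z → concat z ++ concat (reverse A)) (reverse-++ (R ∷ []) B) ⟩
  concat (reverse B ++ R ∷ []) ++ concat (reverse A) ≡⟨ cong (_++ concat (reverse A)) (sym (concat-++ (reverse B) (R ∷ []))) ⟩
  (concat (reverse B) ++ (R ++ [])) ++ concat (reverse A) ≡⟨ cong (λ z → (concat (reverse B) ++ z) ++ concat (reverse A)) (++-identityʳ R) ⟩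
  (concat (reverse B) ++ R) ++ concat (reverse A) ≡⟨ ++-assoc (concat (reverse B)) R _ ⟩
  concat (reverse B) ++ R ++ concat (reverse A) ∎
  where open ≡-Reasoning

rmuA : (i : ℕ) (W1 : Word) → (∀ z → z ∈ W1 → z ≢ suc i) → (idx : ℕ) (acc : Maybe ℕ) (rest : Word) →
  ∃ λ acc' → rmu i 0 idx acc (W1 ++ rest) ≡ rmu i 0 (idx + length W1) acc' rest
rmuA i [] h idx acc rest = acc , cong (λ t → rmu i 0 t acc rest) (sym (+-identityʳ idx))
rmuA i (x ∷ W1) h idx acc rest with x ≡ᵇ i | x ≡ᵇ suc i in e2
... | true | _ with rmuA i W1 (λ z m → h z (there m)) (suc idx) (just idx) rest
...   | acc' , eq = acc' , trans eq (cong (λ t → rmu i 0 t acc' rest) (sym (+-suc idx (length W1))))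
rmuA i (x ∷ W1) h idx acc rest | false | true = ⊥-elim (h x (here refl) (≡ᵇ-true⇒≡ x (suc i) e2))
rmuA i (x ∷ W1) h idx acc rest | false | false with rmuA i W1 (λ z m → h z (there m)) (suc idx) acc rest
...   | acc' , eq = acc' , trans eq (cong (λ t → rmu i 0 t acc' rest) (sym (+-suc idx (length W1))))

rmuB : (i : ℕ) (W2 : Word) → (∀ z → z ∈ W2 → z ≢ i) → (o idx p : ℕ) → rmu i o idx (just p) W2 ≡ just p
rmuB i [] h o idx p = refl
rmuB i (x ∷ W2) h o idx p with x ≡ᵇ i in e1 | x ≡ᵇ suc i | o
... | true | _ | _ = ⊥-elim (h x (here refl) (≡ᵇ-true⇒≡ x i e1))
... | false | true | o' = rmuB i W2 (λ z m → h z (there m)) (suc o') (suc idx) p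
... | false | false | o' = rmuB i W2 (λ z m → h z (there m)) o' (suc idx) p

updAt-mid : {A : Set} (g : A → A) (W1 : List A) (x : A) (W2 : List A) → updAt (length W1) g (W1 ++ x ∷ W2) ≡ W1 ++ g x ∷ W2
updAt-mid g [] x W2 = refl
updAt-mid g (y ∷ W1) x W2 = cong (y ∷_) (updAt-mid g W1 x W2)

splitBy-concat : (L : Tableau) → splitBy (map length L) (concat L) ≡ L
splitBy-concat [] = refl
splitBy-concat (x ∷ L) = cong₂ _∷_ (tk x (concat L)) (trans (cong (splitBy (map length L)) (dr x (concat L))) (splitBy-concat L))
  where
  tk : (x y : List ℕ) → take (length x) (x ++ y) ≡ x
  tk [] y = refl
  tk (a ∷ x) y = cong (a ∷_) (tk x y)
  dr : (x y : List ℕ) → drop (length x) (x ++ y) ≡ y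
  dr [] y = refl
  dr (a ∷ x) y = dr x y

reconstruct : (T X : Tableau) → shape X ≡ shape T → reverse (splitBy (reverse (shape T)) (rw X)) ≡ X
reconstruct T X s = begin
  reverse (splitBy (reverse (shape T)) (rw X)) ≡⟨ cong (λ z → reverse (splitBy (reverse z) (rw X))) (sym s) ⟩
  reverse (splitBy (reverse (map length X)) (concat (reverse X))) ≡⟨ cong (λ z → reverse (splitBy z (concat (reverse X)))) (sym (reverse-map length X)) ⟩
  reverse (splitBy (map length (reverse X)) (concat (reverse X))) ≡⟨ cong reverse (splitBy-concat (reverse X)) ⟩
  reverse (reverse X) ≡⟨ reverse-involutive X ⟩
  X ∎
  where open ≡-Reasoning

fTab-setEntry : (i : ℕ) (T : Tableau) (r c : ℕ) → entry T r c ≡ just i →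
  (∀ r' c' z → r < r' → entry T r' c' ≡ just z → z ≢ suc i) →
  (∀ c' z → c' < c → entry T r c' ≡ just z → z ≢ suc i) →
  (∀ c' z → c < c' → entry T r c' ≡ just z → z ≢ i) →
  (∀ r' c' z → r' < r → entry T r' c' ≡ just z → z ≢ i) →
  fTab i T ≡ just (setEntry r c (suc i) T)
fTab-setEntry i T r c e h1 h2 h3 h4 with entry-just T r c e
... | row , er , ec = f-changes-entry
  where
  A : Tableau
  A = take r T
  B : Tableau
  B = drop (suc r) T
  pre : List ℕ
  pre = take c row
  post : List ℕ
  post = drop (suc c) row
  before : List ℕ
  before = concat (reverse B) ++ pre
  after : List ℕ
  after = post ++ concat (reverse A)
  split : (y : ℕ) → rw (A ++ (pre ++ y ∷ post) ∷ B) ≡ before ++ y ∷ after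
  split y = trans (rw-split A (pre ++ y ∷ post) B) (trans (cong (concat (reverse B) ++_) (++-assoc pre (y ∷ post) _)) (sym (++-assoc (concat (reverse B)) pre _)))
  rwT : rw T ≡ before ++ i ∷ after
  rwT = trans (cong rw (trans (decomp T r er) (cong (λ z → A ++ z ∷ B) (decomp row c ec)))) (split i)
  T'' : Tableau
  T'' = setEntry r c (suc i) T
  rwT'' : rw T'' ≡ before ++ suc i ∷ after
  rwT'' = trans (cong rw (trans (decompU (updAt c (λ _ → suc i)) T r er) (cong (λ z → A ++ z ∷ B) (decompU (λ _ → suc i) row c ec)))) (split (suc i))
  no-successor-before : ∀ z → z ∈ before → z ≢ suc i
  no-successor-before z m with ∈-++⁻ (concat (reverse B)) m
  ... | inj₂ mp with ∈-take row c mp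
  ...   | c' , lt , ez = h2 c' z lt (trans (entry-row T r c' er) ez)
  no-successor-before z m | inj₁ mb with ∈-concat⁻′ (reverse B) mb
  ...   | rw' , zr , rb with ∈-drop T r (reverse⁻ rb)
  ...     | r' , lt , er' with ∈-nth rw' zr
  ...       | c' , ec' = h1 r' c' z lt (trans (entry-row T r' c' er') ec')
  no-letter-after : ∀ z → z ∈ after → z ≢ i
  no-letter-after z m with ∈-++⁻ post m
  ... | inj₁ mp with ∈-drop row c mp
  ...   | c' , lt , ez = h3 c' z lt (trans (entry-row T r c' er) ez)
  no-letter-after z m | inj₂ ma with ∈-concat⁻′ (reverse A) ma
  ...   | rw' , zr , ra with ∈-take T r (reverse⁻ ra)
  ...     | r' , lt , er' with ∈-nth rw' zr
  ...       | c' , ec' = h4 r' c' z lt (trans (entry-row T r' c' er') ec')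
  rmu-finds-entry : rmu i 0 0 nothing (rw T) ≡ just (length before)
  rmu-finds-entry with rmuA i before no-successor-before 0 nothing (i ∷ after)
  ... | acc' , eq rewrite rwT = trans eq (rmu-at-i acc')
    where
    rmu-at-i : (acc' : Maybe ℕ) → rmu i 0 (0 + length before) acc' (i ∷ after) ≡ just (length before)
    rmu-at-i acc' rewrite ≡ᵇ-refl i = rmuB i after no-letter-after 0 (suc (length before)) (length before)
  f-changes-entry : fTab i T ≡ just T''
  f-changes-entry rewrite rmu-finds-entry = cong just (trans (cong (λ w → reverse (splitBy (reverse (shape T)) w)) (trans (cong (updAt (length before) (λ _ → suc i)) rwT) (trans (updAt-mid (λ _ → suc i) before i after) (sym rwT''))))
                          (reconstruct T T'' (shape-setEntry r c (suc i) T)))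

≤∸1⇒< : ∀ {y} k → 1 ≤ y → y ≤ k ∸ 1 → y < k
≤∸1⇒< zero 1≤y y≤0 = ⊥-elim (1+n≰n (≤-trans 1≤y y≤0))
≤∸1⇒< (suc k) _ y≤k = s≤s y≤k

oneTo : ℕ → List ℕ
oneTo m = map suc (upTo m)

oneTo-snoc : (k : ℕ) → oneTo (suc k) ≡ oneTo k ++ (suc k ∷ [])
oneTo-snoc k = trans (cong (map suc) (sym (upTo-∷ʳ k))) (map-++ suc (upTo k) (k ∷ []))

count-oneTo-snoc : (g : ℕ → Bool) (k : ℕ) → count g (oneTo (suc k)) ≡ count g (oneTo k) + bit (g (suc k))
count-oneTo-snoc g k = trans (cong (count g) (oneTo-snoc k)) (count-snoc g (oneTo k) (suc k))

count-oneTo-≡ᵇ : (x k : ℕ) → count (λ y → y ≡ᵇ x) (oneTo k) ≡ (if (1 ≤ᵇ x) ∧ (x ≤ᵇ k) then 1 else 0)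
count-oneTo-≡ᵇ zero zero = refl
count-oneTo-≡ᵇ (suc x) zero = refl
count-oneTo-≡ᵇ x (suc k) rewrite count-oneTo-snoc (λ y → y ≡ᵇ x) k | count-oneTo-≡ᵇ x k with x ≟ suc k
... | yes refl rewrite ≡ᵇ-refl (suc k) | ≰⇒≤ᵇ-false (suc k) k (1+n≰n) | <⇒<ᵇ-true k (suc k) ≤-refl = refl
... | no ne rewrite ≢⇒≡ᵇ-false (suc k) x (λ e → ne (sym e)) with 1 ≤ᵇ x
...   | false = refl
...   | true with x ≤ᵇ k in e1 | x ≤ᵇ suc k in e2
...     | true | true = refl
...     | false | false = refl
...     | true | false = ⊥-elim (≤ᵇ-false⇒≰ x (suc k) e2 (m≤n⇒m≤1+n (≤ᵇ-true⇒≤ x k e1)))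
...     | false | true = ⊥-elim (≤ᵇ-false⇒≰ x k e1 (≤1+-≢⇒≤ (≤ᵇ-true⇒≤ x (suc k) e2)))
  where
  ≤1+-≢⇒≤ : x ≤ suc k → x ≤ k
  ≤1+-≢⇒≤ h with m≤n⇒m<n∨m≡n h
  ... | inj₁ lt = ≤-pred lt
  ... | inj₂ e = ⊥-elim (ne e)

count-oneTo-≡ᵇ-in : (x k : ℕ) → 1 ≤ x → x ≤ k → count (λ y → y ≡ᵇ x) (oneTo k) ≡ 1
count-oneTo-≡ᵇ-in x k h1 h2 rewrite count-oneTo-≡ᵇ x k | ≤⇒≤ᵇ-true 1 x h1 | ≤⇒≤ᵇ-true x k h2 = refl

count-oneTo-≡ᵇ-out : (x k : ℕ) → ¬ (1 ≤ x × x ≤ k) → count (λ y → y ≡ᵇ x) (oneTo k) ≡ 0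
count-oneTo-≡ᵇ-out x k h rewrite count-oneTo-≡ᵇ x k with 1 ≤ᵇ x in e1 | x ≤ᵇ k in e2
... | true | true = ⊥-elim (h (≤ᵇ-true⇒≤ 1 x e1 , ≤ᵇ-true⇒≤ x k e2))
... | true | false = refl
... | false | _ = refl

count-oneTo-all : (g : ℕ → Bool) (k : ℕ) → (∀ y → 1 ≤ y → y ≤ k → g y ≡ true) → count g (oneTo k) ≡ k
count-oneTo-all g zero h = refl
count-oneTo-all g (suc k) h rewrite count-oneTo-snoc g k | count-oneTo-all g k (λ y a b → h y a (m≤n⇒m≤1+n b)) | h (suc k) (s≤s z≤n) ≤-refl = +-comm k 1

count-oneTo-<ᵇ : (x k : ℕ) → x ≤ suc k → count (λ y → y <ᵇ x) (oneTo k) ≡ x ∸ 1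
count-oneTo-<ᵇ x zero h with x
... | zero = refl
... | suc zero = refl
... | suc (suc x') with h
...   | s≤s ()
count-oneTo-<ᵇ x (suc k) h rewrite count-oneTo-snoc (λ y → y <ᵇ x) k with m≤n⇒m<n∨m≡n h
... | inj₂ refl rewrite count-oneTo-all (λ y → y <ᵇ suc (suc k)) k (λ y a b → <⇒<ᵇ-true y (suc (suc k)) (s≤s (m≤n⇒m≤1+n b))) | <⇒<ᵇ-true (suc k) (suc (suc k)) ≤-refl = +-comm k 1
... | inj₁ lt rewrite count-oneTo-<ᵇ x k (≤-pred lt) | ≮⇒<ᵇ-false (suc k) x (λ q → 1+n≰n (≤-trans q (≤-pred lt))) = +-identityʳ _

count-sum : {A : Set} (p q r : A → Bool) (xs : List A) → (∀ x → bit (p x) ≡ bit (q x) + bit (r x)) → count p xs ≡ count q xs + count r xs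
count-sum p q r [] h = refl
count-sum p q r (x ∷ xs) h rewrite count-cons p x xs | count-cons q x xs | count-cons r x xs | h x | count-sum p q r xs h =
  interchange (bit (q x)) (bit (r x)) (count q xs) (count r xs)
  where
  interchange : ∀ a b c d → a + b + (c + d) ≡ a + c + (b + d)
  interchange = solve-∀

nth⇒any-≡ᵇ : (row : List ℕ) (c k : ℕ) → nth row c ≡ just k → any (λ y → y ≡ᵇ k) row ≡ true
nth⇒any-≡ᵇ (y ∷ row) zero k refl rewrite ≡ᵇ-refl k = refl
nth⇒any-≡ᵇ (y ∷ row) (suc c) k e with y ≡ᵇ k
... | true = refl
... | false = nth⇒any-≡ᵇ row c k e

any-≡ᵇ⇒nth : (row : List ℕ) (k : ℕ) → any (λ y → y ≡ᵇ k) row ≡ true → ∃ λ c → nth row c ≡ just k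
any-≡ᵇ⇒nth (y ∷ row) k e with y ≡ᵇ k in eq
... | true = 0 , cong just (≡ᵇ-true⇒≡ y k eq)
... | false with any-≡ᵇ⇒nth row k e
...   | c , ec = suc c , ec

rowOf-contains : (T : Tableau) (r c k : ℕ) → entry T r c ≡ just k → ∃ λ c' → entry T (rowOf T k) c' ≡ just k
rowOf-contains (row ∷ T) r c k e with any (λ y → y ≡ᵇ k) row in eq
... | true = proj₁ (any-≡ᵇ⇒nth row k eq) , proj₂ (any-≡ᵇ⇒nth row k eq)
... | false with r
...   | zero = ⊥-elim (true≢false (trans (sym (nth⇒any-≡ᵇ row c k e)) eq))
...   | suc r' = rowOf-contains T r' c k e

module Standard (S : Tableau) (stdS : IsStandard S) where
  m : ℕ
  m = size S

  count-concat-oneTo : (g : ℕ → Bool) → count g (concat S) ≡ count g (oneTo m)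
  count-concat-oneTo g = count-↭ g (proj₂ stdS)

  count-cells-oneTo : (g : ℕ → Bool) → count (λ e → g (valE e)) (cells S) ≡ count g (oneTo m)
  count-cells-oneTo g = trans (count-cells g S) (count-concat-oneTo g)

  occurs : (r c x : ℕ) → entry S r c ≡ just x → 1 ≤ count (λ y → y ≡ᵇ x) (oneTo m)
  occurs r c x e = subst (1 ≤_) (count-cells-oneTo (λ y → y ≡ᵇ x)) (∈⇒count≥1 (λ e → valE e ≡ᵇ x) (cells S) (r , c , x) (mem-cells S r c x e) (≡ᵇ-refl x))

  val-range : (r c x : ℕ) → entry S r c ≡ just x → 1 ≤ x × x ≤ m
  val-range r c x e with 1 ≤? x | x ≤? m
  ... | yes a | yes b = a , b
  ... | no na | _ = ⊥-elim (1+n≰n (subst (1 ≤_) (count-oneTo-≡ᵇ-out x m (λ q → na (proj₁ q))) (occurs r c x e)))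
  ... | yes _ | no nb = ⊥-elim (1+n≰n (subst (1 ≤_) (count-oneTo-≡ᵇ-out x m (λ q → nb (proj₂ q))) (occurs r c x e)))

  pos-exists : (x : ℕ) → 1 ≤ x → x ≤ m → ∃₂ λ r c → entry S r c ≡ just x
  pos-exists x h1 h2 with count≥1⇒∈ (λ e → valE e ≡ᵇ x) (cells S) (≤-reflexive (sym (trans (count-cells-oneTo (λ y → y ≡ᵇ x)) (count-oneTo-≡ᵇ-in x m h1 h2))))
  ... | (r , c , y) , mem , ey with ≡ᵇ-true⇒≡ y x ey
  ...   | refl = r , c , cells-mem S r c y mem

  no-repeat : (r c r' c' x : ℕ) → entry S r c ≡ just x → entry S r' c' ≡ just x → ¬ (r ≡ r' × c ≡ c') → ⊥
  no-repeat r c r' c' x e e' ne with cells-split S r c x e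
  ... | A , B , eq , _ , off = 1+n≰n (≤-trans two (≤-reflexive (trans (count-cells-oneTo (λ y → y ≡ᵇ x)) (count-oneTo-≡ᵇ-in x m (proj₁ (val-range r c x e)) (proj₂ (val-range r c x e))))))
    where
    p : Cell → Bool
    p = λ e → valE e ≡ᵇ x
    inAB : (r' , c' , x) ∈ A ++ B
    inAB = lemma A (subst ((r' , c' , x) ∈_) eq (mem-cells S r' c' x e'))
      where
      lemma : (A' : List Cell) → (r' , c' , x) ∈ A' ++ (r , c , x) ∷ B → (r' , c' , x) ∈ A' ++ B
      lemma [] (here refl) = ⊥-elim (ne (refl , refl))
      lemma [] (there m) = m
      lemma (a ∷ A') (here q) = here q
      lemma (a ∷ A') (there m) = there (lemma A' m)
    oneAB : 1 ≤ count p (A ++ B)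
    oneAB = ∈⇒count≥1 p (A ++ B) (r' , c' , x) inAB (≡ᵇ-refl x)
    two : 2 ≤ count p (cells S)
    two rewrite eq | count-++ p A ((r , c , x) ∷ B) | count-cons p (r , c , x) B | ≡ᵇ-refl x =
      subst (2 ≤_) (sym (+-suc (count p A) (count p B))) (s≤s (subst (1 ≤_) (count-++ p A B) oneAB))

  position-unique : (r c r' c' x : ℕ) → entry S r c ≡ just x → entry S r' c' ≡ just x → r ≡ r' × c ≡ c'
  position-unique r c r' c' x e e' with r ≟ r' | c ≟ c'
  ... | yes a | yes b = a , b
  ... | yes a | no nb = ⊥-elim (no-repeat r c r' c' x e e' (λ q → nb (proj₂ q)))
  ... | no na | _ = ⊥-elim (no-repeat r c r' c' x e e' (λ q → na (proj₁ q)))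

  rowOf-pos : (r c k : ℕ) → entry S r c ≡ just k → rowOf S k ≡ r
  rowOf-pos r c k e with rowOf-contains S r c k e
  ... | c' , e' = proj₁ (position-unique (rowOf S k) c' r c k e' e)

Increasing : List ℕ → Set
Increasing [] = ⊤
Increasing (y ∷ ys) = All (y <_) ys × Increasing ys

All-filterB : {P : ℕ → Set} (p : ℕ → Bool) (xs : List ℕ) → All P xs → All P (filterB p xs)
All-filterB p [] [] = []
All-filterB p (x ∷ xs) (px ∷ a) with p x
... | true = px ∷ All-filterB p xs a
... | false = All-filterB p xs a

Increasing-filterB : (p : ℕ → Bool) (xs : List ℕ) → Increasing xs → Increasing (filterB p xs)
Increasing-filterB p [] h = tt
Increasing-filterB p (x ∷ xs) (a , h) with p x
... | true = All-filterB p xs a , Increasing-filterB p xs h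
... | false = Increasing-filterB p xs h

Increasing-snoc : (xs : List ℕ) (z : ℕ) → Increasing xs → All (_< z) xs → Increasing (xs ++ z ∷ [])
Increasing-snoc [] z h a = [] , tt
Increasing-snoc (x ∷ xs) z (ax , h) (xz ∷ a) = AllP.∷ʳ⁺ ax xz , Increasing-snoc xs z h a

oneTo-range : (k : ℕ) → All (λ y → 1 ≤ y × y ≤ k) (oneTo k)
oneTo-range zero = []
oneTo-range (suc k) = subst (All (λ y → 1 ≤ y × y ≤ suc k)) (sym (oneTo-snoc k))
  (AllP.∷ʳ⁺ (All.map (λ { (a , b) → a , m≤n⇒m≤1+n b }) (oneTo-range k)) (s≤s z≤n , ≤-refl))

oneTo-increasing : (k : ℕ) → Increasing (oneTo k)
oneTo-increasing zero = tt
oneTo-increasing (suc k) = subst Increasing (sym (oneTo-snoc k)) (Increasing-snoc (oneTo k) (suc k) (oneTo-increasing k) (All.map (λ { (a , b) → s≤s b }) (oneTo-range k)))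

label≥1 : (α : List ℕ) (x : ℕ) → 1 ≤ label α x
label≥1 [] x = s≤s z≤n
label≥1 (a ∷ α) x with x ≤ᵇ a
... | true = s≤s z≤n
... | false = s≤s z≤n

label-mono : (α : List ℕ) (x y : ℕ) → x ≤ y → label α x ≤ label α y
label-mono [] x y h = ≤-refl
label-mono (a ∷ α) x y h with x ≤ᵇ a in e1 | y ≤ᵇ a in e2
... | true | _ = subst (1 ≤_) (label-cons e2) (label≥1 (a ∷ α) y)
  where
  label-cons : ∀ {b} → (y ≤ᵇ a) ≡ b → label (a ∷ α) y ≡ (if b then 1 else suc (label α (y ∸ a)))
  label-cons refl = refl
... | false | true = ⊥-elim (≤ᵇ-false⇒≰ x a e1 (≤-trans h (≤ᵇ-true⇒≤ y a e2)))
... | false | false = s≤s (label-mono α (x ∸ a) (y ∸ a) (∸-monoˡ-≤ a h))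

count-filterB : (p q : ℕ → Bool) (xs : List ℕ) → count q (filterB p xs) ≡ count (λ x → p x ∧ q x) xs
count-filterB p q [] = refl
count-filterB p q (x ∷ xs) with p x
... | true with q x
...   | true = cong suc (count-filterB p q xs)
...   | false = count-filterB p q xs
count-filterB p q (x ∷ xs) | false = count-filterB p q xs

length-diffs : (p : ℕ) (ys : List ℕ) → length (diffs p ys) ≡ length ys
length-diffs p [] = refl
length-diffs p (y ∷ ys) = cong suc (length-diffs y ys)

label-diffs : (p : ℕ) (ys : List ℕ) → Increasing ys → All (p <_) ys → (x : ℕ) → 1 ≤ x →
  label (diffs p ys) x ≡ suc (count (λ y → y <ᵇ p + x) ys)
label-diffs p [] h a x hx = refl
label-diffs p (y ∷ ys) (ay , h) (py ∷ a) x hx with x ≤ᵇ y ∸ p in e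
... | true = cong suc (sym (count-false (λ z → z <ᵇ p + x) (y ∷ ys) (λ _ → All.lookup (≮⇒<ᵇ-false y (p + x) (λ q → 1+n≰n (≤-trans q ylim)) ∷ All.map (λ {z} yz → ≮⇒<ᵇ-false z (p + x) (λ q → 1+n≰n (≤-trans q (≤-trans ylim (<⇒≤ yz))))) ay))))
  where
  ylim : p + x ≤ y
  ylim = subst (_≤ y) (+-comm x p) (subst (x + p ≤_) (m∸n+n≡m (<⇒≤ py)) (+-monoˡ-≤ p (≤ᵇ-true⇒≤ x (y ∸ p) e)))
... | false = recurse xgt ylt eqpx
  where
  xgt : y ∸ p < x
  xgt = ≰⇒> (≤ᵇ-false⇒≰ x (y ∸ p) e)
  ylt : y < p + x
  ylt = subst (_< p + x) (m+[n∸m]≡n (<⇒≤ py)) (+-monoʳ-< p xgt)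
  eqpx : y + (x ∸ (y ∸ p)) ≡ p + x
  eqpx = trans (cong (_+ (x ∸ (y ∸ p))) (sym (m+[n∸m]≡n (<⇒≤ py)))) (trans (+-assoc p (y ∸ p) _) (cong (p +_) (m+[n∸m]≡n (<⇒≤ xgt))))
  recurse : y ∸ p < x → y < p + x → y + (x ∸ (y ∸ p)) ≡ p + x → suc (label (diffs y ys) (x ∸ (y ∸ p))) ≡ suc (count (λ z → z <ᵇ p + x) (y ∷ ys))
  recurse xgt ylt eqpx rewrite label-diffs y ys h ay (x ∸ (y ∸ p)) (m<n⇒0<n∸m xgt) | <⇒<ᵇ-true y (p + x) ylt = cong (λ t → suc (suc (count (λ z → z <ᵇ t) ys))) eqpx

sum-diffs : (p : ℕ) (ys : List ℕ) (z : ℕ) → Increasing (ys ++ z ∷ []) → All (p <_) ys → p ≤ z → sum (diffs p (ys ++ z ∷ [])) ≡ z ∸ p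
sum-diffs p [] z h a pz = +-identityʳ (z ∸ p)
sum-diffs p (y ∷ ys) z (ay , h) (py ∷ a) pz =
  trans (cong ((y ∸ p) +_) (sum-diffs y ys z h (init ys ay) (<⇒≤ (last ys ay))))
        (telescope (<⇒≤ py) (<⇒≤ (last ys ay)))
  where
  init : (ys : List ℕ) → All (y <_) (ys ++ z ∷ []) → All (y <_) ys
  init [] _ = []
  init (q ∷ ys) (h ∷ a) = h ∷ init ys a
  last : (ys : List ℕ) → All (y <_) (ys ++ z ∷ []) → y < z
  last [] (h ∷ _) = h
  last (q ∷ ys) (_ ∷ a) = last ys a
  telescope : ∀ {p y z} → p ≤ y → y ≤ z → (y ∸ p) + (z ∸ y) ≡ z ∸ p
  telescope {p} {y} {z} py yz = +-cancelʳ-≡ p _ _ (begin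
    (y ∸ p) + (z ∸ y) + p ≡⟨ trans (+-assoc (y ∸ p) _ p) (trans (cong ((y ∸ p) +_) (+-comm (z ∸ y) p)) (sym (+-assoc (y ∸ p) p _))) ⟩
    (y ∸ p) + p + (z ∸ y) ≡⟨ cong (_+ (z ∸ y)) (m∸n+n≡m py) ⟩
    y + (z ∸ y) ≡⟨ m+[n∸m]≡n yz ⟩
    z ≡⟨ sym (m∸n+n≡m (≤-trans py yz)) ⟩
    z ∸ p + p ∎)
    where open ≡-Reasoning

module Descents (S : Tableau) (stdS : IsStandard S) where
  open Standard S stdS public

  tabS : IsTableau S
  tabS = proj₁ stdS

  isDescent : ℕ → Bool
  isDescent x = rowOf S x <ᵇ rowOf S (suc x)

  des : List ℕ
  des = descents S

  α : List ℕ
  α = desComp S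

  des-range : All (λ y → 1 ≤ y × y ≤ m ∸ 1) des
  des-range = All-filterB isDescent (oneTo (m ∸ 1)) (oneTo-range (m ∸ 1))

  des-increasing : Increasing des
  des-increasing = Increasing-filterB isDescent (oneTo (m ∸ 1)) (oneTo-increasing (m ∸ 1))

  des∷ʳm-increasing : Increasing (des ++ m ∷ [])
  des∷ʳm-increasing = Increasing-snoc des m des-increasing (All.map (λ { (a , b) → ≤∸1⇒< m a b }) des-range)

  label-α : (x : ℕ) → 1 ≤ x → x ≤ m → label α x ≡ suc (count (λ d → d <ᵇ x) des)
  label-α x hx hm = trans (label-diffs 0 (des ++ m ∷ []) des∷ʳm-increasing allpos x hx)
                   (cong suc (trans (count-++ (λ d → d <ᵇ x) des (m ∷ [])) (trans (cong (count (λ d → d <ᵇ x) des +_) mfalse) (+-identityʳ _))))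
    where
    allpos : All (0 <_) (des ++ m ∷ [])
    allpos = AllP.∷ʳ⁺ (All.map proj₁ des-range) (≤-trans hx hm)
    mfalse : count (λ d → d <ᵇ x) (m ∷ []) ≡ 0
    mfalse rewrite ≮⇒<ᵇ-false m x (λ q → 1+n≰n (≤-trans q hm)) = refl

  count-des-≡ᵇ : (x : ℕ) → 1 ≤ x → x ≤ m ∸ 1 → count (λ d → d ≡ᵇ x) des ≡ bit (isDescent x)
  count-des-≡ᵇ x h1 h2 = trans (count-filterB isDescent (λ d → d ≡ᵇ x) (oneTo (m ∸ 1))) (trans (count-ext∈ _ (λ d → isDescent x ∧ (d ≡ᵇ x)) (oneTo (m ∸ 1)) pt) count-single)
    where
    pt : ∀ d → _ → (isDescent d ∧ (d ≡ᵇ x)) ≡ (isDescent x ∧ (d ≡ᵇ x))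
    pt d _ with d ≡ᵇ x in e
    ... | false = trans (∧-zeroʳ (isDescent d)) (sym (∧-zeroʳ (isDescent x)))
    ... | true rewrite ≡ᵇ-true⇒≡ d x e = refl
    count-single : count (λ d → isDescent x ∧ (d ≡ᵇ x)) (oneTo (m ∸ 1)) ≡ bit (isDescent x)
    count-single with isDescent x
    ... | true = count-oneTo-≡ᵇ-in x (m ∸ 1) h1 h2
    ... | false = count-false (λ d → false) (oneTo (m ∸ 1)) (λ _ _ → refl)

  label-α-suc : (x : ℕ) → 1 ≤ x → suc x ≤ m → label α (suc x) ≡ label α x + bit (isDescent x)
  label-α-suc x hx hm rewrite label-α (suc x) (s≤s z≤n) hm | label-α x hx (<⇒≤ hm) =
    cong suc (trans (count-sum (λ d → d <ᵇ suc x) (λ d → d <ᵇ x) (λ d → d ≡ᵇ x) des pt)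
                    (cong (count (λ d → d <ᵇ x) des +_) (count-des-≡ᵇ x hx (≤-trans (≤-reflexive (sym (m+n∸m≡n 1 x))) (∸-monoˡ-≤ 1 hm)))))
    where
    pt : ∀ d → bit (d <ᵇ suc x) ≡ bit (d <ᵇ x) + bit (d ≡ᵇ x)
    pt d with <-cmp d x
    ... | tri< a _ _ rewrite <⇒<ᵇ-true d (suc x) (m≤n⇒m≤1+n a) | <⇒<ᵇ-true d x a | ≢⇒≡ᵇ-false d x (λ q → <-irrefl q a) = refl
    ... | tri≈ _ refl _ rewrite <⇒<ᵇ-true d (suc d) ≤-refl | ≮⇒<ᵇ-false d d (<-irrefl refl) | ≡ᵇ-refl d = refl
    ... | tri> _ _ c rewrite ≮⇒<ᵇ-false d (suc x) (λ q → 1+n≰n (≤-trans (s≤s c) q)) | ≮⇒<ᵇ-false d x (λ q → <-irrefl refl (<-trans q c)) | ≢⇒≡ᵇ-false d x (λ q → <-irrefl (sym q) c) = refl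

  length-α : length α ≡ suc (length des)
  length-α = trans (length-diffs 0 (des ++ m ∷ [])) (trans (length-++ des) (+-comm (length des) 1))

  sum-α : sum α ≡ m
  sum-α = sum-diffs 0 des m des∷ʳm-increasing (All.map proj₁ des-range) z≤n

  label-α≤length : (x : ℕ) → 1 ≤ x → x ≤ m → label α x ≤ length α
  label-α≤length x hx hm rewrite label-α x hx hm | length-α = s≤s (count-≤len _ des)

  label-α-last : 1 ≤ m → label α m ≡ length α
  label-α-last hm rewrite label-α m hm ≤-refl | length-α = cong suc (count-true (λ d → d <ᵇ m) des (λ _ → All.lookup (All.map (λ { (a , b) → <⇒<ᵇ-true _ m (≤∸1⇒< m a b) }) des-range)))

  label-α-1 : 1 ≤ m → label α 1 ≡ 1
  label-α-1 hm rewrite label-α 1 ≤-refl hm = cong suc (count-false (λ d → d <ᵇ 1) des (λ _ → All.lookup (All.map (λ { {y} (a , b) → ≮⇒<ᵇ-false y 1 (λ q → 1+n≰n (≤-trans (s≤s a) q)) }) des-range)))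

  noDescents⇒label≡ : (s k : ℕ) → 1 ≤ s → s + k ≤ m → (∀ j → s ≤ j → j < s + k → isDescent j ≡ false) → label α s ≡ label α (s + k)
  noDescents⇒label≡ s zero hs hm h = cong (label α) (sym (+-identityʳ s))
  noDescents⇒label≡ s (suc k) hs hm h rewrite +-suc s k =
    trans (noDescents⇒label≡ s k hs (<⇒≤ hm) (λ j a b → h j a (m≤n⇒m≤1+n b)))
          (sym (trans (label-α-suc (s + k) (≤-trans hs (m≤m+n s k)) hm) (trans (cong (λ b → label α (s + k) + bit b) (h (s + k) (m≤m+n s k) ≤-refl)) (+-identityʳ _))))

  label≡⇒noDescents : (s k : ℕ) → 1 ≤ s → s + k ≤ m → label α s ≡ label α (s + k) → ∀ j → s ≤ j → j < s + k → isDescent j ≡ false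
  label≡⇒noDescents s k hs hm eq j a b with isDescent j in e
  ... | false = refl
  ... | true = ⊥-elim (1+n≰n (≤-trans lt (≤-reflexive (sym eq))))
    where
    jm : suc j ≤ m
    jm = ≤-trans b hm
    st : label α (suc j) ≡ label α j + 1
    st = trans (label-α-suc j (≤-trans hs a) jm) (cong (λ t → label α j + bit t) e)
    lt : label α s < label α (s + k)
    lt = ≤-trans (s≤s (label-mono α s j a)) (≤-trans (≤-reflexive (trans (+-comm 1 _) (sym st))) (label-mono α (suc j) (s + k) b))

  nonDescent-position : (k r c r' c' : ℕ) → suc k ≤ m → isDescent k ≡ false → entry S r c ≡ just k → entry S r' c' ≡ just (suc k) → r' ≤ r × c < c'
  nonDescent-position k r c r' c' hm d e e' = rr , cc
    where
    rr : r' ≤ r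
    rr = ≮⇒≥ (λ q → <ᵇ-false⇒≮ (rowOf S k) (rowOf S (suc k)) d (subst₂ _<_ (sym (rowOf-pos r c k e)) (sym (rowOf-pos r' c' (suc k) e')) q))
    cc : c < c'
    cc = ≰⇒> (λ q → 1+n≰n (rect≤ S tabS r' c' r c rr q e' e))

  descent-row< : (k r c r' c' : ℕ) → isDescent k ≡ true → entry S r c ≡ just k → entry S r' c' ≡ just (suc k) → r < r'
  descent-row< k r c r' c' d e e' = subst₂ _<_ (rowOf-pos r c k e) (rowOf-pos r' c' (suc k) e') (<ᵇ-true⇒< _ _ d)

  noDescents-position : (s k r c r' c' : ℕ) → 1 ≤ s → s + suc k ≤ m → (∀ j → s ≤ j → j < s + suc k → isDescent j ≡ false) →
    entry S r c ≡ just s → entry S r' c' ≡ just (s + suc k) → r' ≤ r × c < c'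
  noDescents-position s zero r c r' c' hs hm h e e' =
    nonDescent-position s r c r' c' (subst (_≤ m) (+-comm s 1) hm) (h s ≤-refl (subst (s <_) (sym (+-comm s 1)) ≤-refl)) e (subst (λ t → entry S r' c' ≡ just t) (+-comm s 1) e')
  noDescents-position s (suc k) r c r' c' hs hm h e e' with pos-exists (s + suc k) (≤-trans hs (m≤m+n s (suc k))) (≤-trans (+-monoʳ-≤ s (n≤1+n (suc k))) hm)
  ... | rp , cp , ep with noDescents-position s k r c rp cp hs (≤-trans (+-monoʳ-≤ s (n≤1+n (suc k))) hm) (λ j a b → h j a (≤-trans b (+-monoʳ-≤ s (n≤1+n (suc k))))) e ep
  ...   | r1 , c1 with nonDescent-position (s + suc k) rp cp r' c' (subst (_≤ m) (+-suc s (suc k)) hm) (h (s + suc k) (m≤m+n s (suc k)) (subst (s + suc k <_) (sym (+-suc s (suc k))) ≤-refl)) ep (subst (λ t → entry S r' c' ≡ just t) (+-suc s (suc k)) e')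
  ...     | r2 , c2 = ≤-trans r2 r1 , <-trans c1 c2

  sameLabel-position : (s t r c r' c' : ℕ) → entry S r c ≡ just s → entry S r' c' ≡ just t → s < t → label α s ≡ label α t → r' ≤ r × c < c'
  sameLabel-position s t r c r' c' es et lt eq =
    noDescents-position s (t ∸ suc s) r c r' c' hs ht' (λ j a b → label≡⇒noDescents s (suc (t ∸ suc s)) hs ht' eq' j a b) es et'
    where
    hs : 1 ≤ s
    hs = proj₁ (val-range r c s es)
    tt' : s + suc (t ∸ suc s) ≡ t
    tt' = trans (+-suc s (t ∸ suc s)) (m+[n∸m]≡n lt)
    ht' : s + suc (t ∸ suc s) ≤ m
    ht' = subst (_≤ m) (sym tt') (proj₂ (val-range r' c' t et))
    eq' : label α s ≡ label α (s + suc (t ∸ suc s))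
    eq' = trans eq (cong (label α) (sym tt'))
    et' : entry S r' c' ≡ just (s + suc (t ∸ suc s))
    et' = trans et (cong just (sym tt'))

precedes : ℕ → ℕ → Cell → Bool
precedes c x e = (valE e <ᵇ x) ∨ ((valE e ≡ᵇ x) ∧ (colE e <ᵇ c))

stdValue : Tableau → ℕ → ℕ → ℕ
stdValue T c x = stdVal (cells T) c x

nth-stdRow : (cs : List Cell) (k : ℕ) (row : List ℕ) (c : ℕ) → nth (stdRow cs k row) c ≡ M.map (stdVal cs (k + c)) (nth row c)
nth-stdRow cs k [] c = refl
nth-stdRow cs k (x ∷ row) zero rewrite +-identityʳ k = refl
nth-stdRow cs k (x ∷ row) (suc c) rewrite +-suc k c = nth-stdRow cs (suc k) row c

entry-std : (T : Tableau) (r c : ℕ) → entry (std T) r c ≡ M.map (stdValue T c) (entry T r c)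
entry-std T r c with nth T r in eq
... | nothing = entry-nothing (std T) r c (trans (nth-map (stdRow (cells T) 0) T r) (cong (M.map (stdRow (cells T) 0)) eq))
... | just row = trans (entry-row (std T) r c (trans (nth-map (stdRow (cells T) 0) T r) (cong (M.map (stdRow (cells T) 0)) eq))) (nth-stdRow (cells T) 0 row c)

module StdValueOrder (T : Tableau) where
  stdValue-< : (r c x r' c' y : ℕ) → entry T r c ≡ just x → entry T r' c' ≡ just y → y < x → stdValue T c' y < stdValue T c x
  stdValue-< r c x r' c' y ex ey lt = s≤s (count-strict∈ (precedes c' y) (precedes c x) (cells T) imp (r' , c' , y) (mem-cells T r' c' y ey) pb pa)
    where
    imp : ∀ e → _ → precedes c' y e ≡ true → precedes c x e ≡ true
    imp (_ , c'' , v) _ h with v <ᵇ y in e1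
    ... | true rewrite <⇒<ᵇ-true v x (<-trans (<ᵇ-true⇒< v y e1) lt) = refl
    ... | false with v ≡ᵇ y in e2
    ...   | true rewrite ≡ᵇ-true⇒≡ v y e2 | <⇒<ᵇ-true y x lt = refl
    ...   | false with h
    ...     | ()
    pb : precedes c' y (r' , c' , y) ≡ false
    pb rewrite ≮⇒<ᵇ-false y y (<-irrefl refl) | ≡ᵇ-refl y | ≮⇒<ᵇ-false c' c' (<-irrefl refl) = refl
    pa : precedes c x (r' , c' , y) ≡ true
    pa rewrite <⇒<ᵇ-true y x lt = refl

  stdValue-col : (r c x r' c' : ℕ) → entry T r c ≡ just x → entry T r' c' ≡ just x → c' < c → stdValue T c' x < stdValue T c x
  stdValue-col r c x r' c' ex ey lt = s≤s (count-strict∈ (precedes c' x) (precedes c x) (cells T) imp (r' , c' , x) (mem-cells T r' c' x ey) pb pa)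
    where
    imp : ∀ e → _ → precedes c' x e ≡ true → precedes c x e ≡ true
    imp (_ , c'' , v) _ h with v <ᵇ x
    ... | true = refl
    ... | false with v ≡ᵇ x
    ...   | false = h
    ...   | true rewrite <⇒<ᵇ-true c'' c (<-trans (<ᵇ-true⇒< c'' c' h) lt) = refl
    pb : precedes c' x (r' , c' , x) ≡ false
    pb rewrite ≮⇒<ᵇ-false x x (<-irrefl refl) | ≡ᵇ-refl x | ≮⇒<ᵇ-false c' c' (<-irrefl refl) = refl
    pa : precedes c x (r' , c' , x) ≡ true
    pa rewrite ≮⇒<ᵇ-false x x (<-irrefl refl) | ≡ᵇ-refl x | <⇒<ᵇ-true c' c lt = refl

module Standardizes (S : Tableau) (stdS : IsStandard S) (T : Tableau) (shT : shape T ≡ shape S) (tabT : IsTableau T) (stdT : std T ≡ S) where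
  open Descents S stdS public
  open StdValueOrder T

  entry-std-just : (r c x : ℕ) → entry T r c ≡ just x → entry S r c ≡ just (stdValue T c x)
  entry-std-just r c x e = trans (sym (cong (λ Z → entry Z r c) stdT)) (trans (entry-std T r c) (cong (M.map (stdValue T c)) e))

  entry-at : (r c s : ℕ) → entry S r c ≡ just s → ∃ λ x → entry T r c ≡ just x
  entry-at r c s e = shape-entry S T (sym shT) r c e

  stdValue≡ : (r c x s : ℕ) → entry T r c ≡ just x → entry S r c ≡ just s → stdValue T c x ≡ s
  stdValue≡ r c x s ex es = just-injective (trans (sym (entry-std-just r c x ex)) es)

  std<⇒≤ : (r c x s r' c' y t : ℕ) → entry T r c ≡ just x → entry S r c ≡ just s → entry T r' c' ≡ just y → entry S r' c' ≡ just t →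
    s < t → x ≤ y
  std<⇒≤ r c x s r' c' y t ex es ey et lt = ≮⇒≥ (λ yx → <-asym lt (subst₂ _<_ (stdValue≡ r' c' y t ey et) (stdValue≡ r c x s ex es) (stdValue-< r c x r' c' y ex ey yx)))

  std≤⇒≤ : (r c x s r' c' y t : ℕ) → entry T r c ≡ just x → entry S r c ≡ just s → entry T r' c' ≡ just y → entry S r' c' ≡ just t →
    s ≤ t → x ≤ y
  std≤⇒≤ r c x s r' c' y t ex es ey et le with m≤n⇒m<n∨m≡n le
  ... | inj₁ lt = std<⇒≤ r c x s r' c' y t ex es ey et lt
  ... | inj₂ refl with position-unique r c r' c' s es et
  ...   | refl , refl = ≤-reflexive (just-injective (trans (sym ex) ey))

  <⇒std< : (r c x s r' c' y t : ℕ) → entry T r c ≡ just x → entry S r c ≡ just s → entry T r' c' ≡ just y → entry S r' c' ≡ just t →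
    x < y → s < t
  <⇒std< r c x s r' c' y t ex es ey et lt = subst₂ _<_ (stdValue≡ r c x s ex es) (stdValue≡ r' c' y t ey et) (stdValue-< r' c' y r c x ey ex lt)

  sameEntry-col< : (r c x s r' c' t : ℕ) → entry T r c ≡ just x → entry S r c ≡ just s → entry T r' c' ≡ just x → entry S r' c' ≡ just t →
    s < t → c < c'
  sameEntry-col< r c x s r' c' t ex es ey et lt with <-cmp c c'
  ... | tri< a _ _ = a
  ... | tri≈ _ refl _ = ⊥-elim (<-irrefl (trans (sym (stdValue≡ r c x s ex es)) (stdValue≡ r' c x t ey et)) lt)
  ... | tri> _ _ b = ⊥-elim (<-asym lt (subst₂ _<_ (stdValue≡ r' c' x t ey et) (stdValue≡ r c x s ex es) (stdValue-col r c x r' c' ex ey b)))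

  descent⇒< : (r c x s r' c' y t d : ℕ) → entry T r c ≡ just x → entry S r c ≡ just s → entry T r' c' ≡ just y → entry S r' c' ≡ just t →
    s ≤ d → d < t → isDescent d ≡ true → x < y
  descent⇒< r c x s r' c' y t d ex es ey et sd dt isd with pos-exists d (≤-trans (proj₁ (val-range r c s es)) sd) (<⇒≤ (≤-trans dt (proj₂ (val-range r' c' t et))))
                                                      | pos-exists (suc d) (s≤s z≤n) (≤-trans dt (proj₂ (val-range r' c' t et)))
  ... | r1 , c1 , e1 | r2 , c2 , e2 with entry-at r1 c1 d e1 | entry-at r2 c2 (suc d) e2
  ...   | x1 , ex1 | x2 , ex2 = ≤-<-trans (std≤⇒≤ r c x s r1 c1 x1 d ex es ex1 e1 sd) (<-≤-trans mid (std≤⇒≤ r2 c2 x2 (suc d) r' c' y t ex2 e2 ey et dt))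
    where
    mid : x1 < x2
    mid with m≤n⇒m<n∨m≡n (std<⇒≤ r1 c1 x1 d r2 c2 x2 (suc d) ex1 e1 ex2 e2 ≤-refl)
    ... | inj₁ lt = lt
    ... | inj₂ refl = ⊥-elim (<-irrefl refl (rect< T tabT r1 c1 r2 c2 (descent-row< d r1 c1 r2 c2 isd e1 e2) (<⇒≤ (sameEntry-col< r1 c1 x1 d r2 c2 (suc d) ex1 e1 ex2 e2 ≤-refl)) ex1 ex2))

  label-α≤entry-step : (k r c x : ℕ) → entry S r c ≡ just (suc (suc k)) → entry T r c ≡ just x →
    (∀ r1 c1 x1 → entry S r1 c1 ≡ just (suc k) → entry T r1 c1 ≡ just x1 → label α (suc k) ≤ x1) → label α (suc (suc k)) ≤ x
  label-α≤entry-step k r c x es ex IH with pos-exists (suc k) (s≤s z≤n) (<⇒≤ (proj₂ (val-range r c _ es)))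
  ... | r1 , c1 , e1 with entry-at r1 c1 (suc k) e1
  ...   | x1 , ex1 with IH r1 c1 x1 e1 ex1
  ...     | ih rewrite label-α-suc (suc k) (s≤s z≤n) (proj₂ (val-range r c _ es)) with isDescent (suc k) in eD
  ...       | true = subst (_≤ x) (+-comm 1 (label α (suc k))) (≤-<-trans ih (descent⇒< r1 c1 x1 (suc k) r c x (suc (suc k)) (suc k) ex1 e1 ex es ≤-refl ≤-refl eD))
  ...       | false = subst (_≤ x) (sym (+-identityʳ _)) (≤-trans ih (std<⇒≤ r1 c1 x1 (suc k) r c x (suc (suc k)) ex1 e1 ex es ≤-refl))

  label-α≤entry : (∀ r c x → entry T r c ≡ just x → 1 ≤ x) → (s r c x : ℕ) → entry S r c ≡ just s → entry T r c ≡ just x → label α s ≤ x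
  label-α≤entry hpos zero r c x es ex = ⊥-elim (1+n≰n (proj₁ (val-range r c 0 es)))
  label-α≤entry hpos (suc zero) r c x es ex = subst (_≤ x) (sym (label-α-1 (proj₂ (val-range r c 1 es)))) (hpos r c x ex)
  label-α≤entry hpos (suc (suc k)) r c x es ex = label-α≤entry-step k r c x es ex (λ r1 c1 x1 e1 ex1 → label-α≤entry hpos (suc k) r1 c1 x1 e1 ex1)

  entry≤shiftedLabel-step : (n : ℕ) (k s r c x : ℕ) → s + suc k ≡ m → entry S r c ≡ just s → entry T r c ≡ just x →
    (∀ r1 c1 y → entry S r1 c1 ≡ just (suc s) → entry T r1 c1 ≡ just y → y ≤ (n ∸ length α) + label α (suc s)) →
    x ≤ (n ∸ length α) + label α s
  entry≤shiftedLabel-step n k s r c x sk es ex IH with pos-exists (suc s) (s≤s z≤n) (subst (suc s ≤_) sk (subst (_≤ s + suc k) (+-comm s 1) (+-monoʳ-≤ s (s≤s z≤n))))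
  ... | r1 , c1 , e1 with entry-at r1 c1 (suc s) e1
  ...   | y , ey with IH r1 c1 y e1 ey
  ...     | ih rewrite label-α-suc s (proj₁ (val-range r c s es)) (proj₂ (val-range r1 c1 (suc s) e1)) with isDescent s in eD
  ...       | true = +-cancelʳ-≤ 1 x _ (subst₂ _≤_ (+-comm 1 x) (sym (+-assoc (n ∸ length α) (label α s) 1)) (≤-trans (descent⇒< r c x s r1 c1 y (suc s) s ex es ey e1 ≤-refl ≤-refl eD) ih))
  ...       | false = ≤-trans (std<⇒≤ r c x s r1 c1 y (suc s) ex es ey e1 ≤-refl) (subst (y ≤_) (cong ((n ∸ length α) +_) (+-identityʳ (label α s))) ih)

  entry≤shiftedLabel : (n : ℕ) → length α ≤ n → (∀ r c x → entry T r c ≡ just x → x ≤ n) → (k s r c x : ℕ) → s + k ≡ m →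
    entry S r c ≡ just s → entry T r c ≡ just x → x ≤ (n ∸ length α) + label α s
  entry≤shiftedLabel n hL hn zero s r c x sk es ex rewrite +-identityʳ s | sk | label-α-last (≤-trans (proj₁ (val-range r c m es)) (proj₂ (val-range r c m es))) | m∸n+n≡m hL = hn r c x ex
  entry≤shiftedLabel n hL hn (suc k) s r c x sk es ex = entry≤shiftedLabel-step n k s r c x sk es ex (λ r1 c1 y e1 ey → entry≤shiftedLabel n hL hn k (suc s) r1 c1 y (trans (sym (+-suc s k)) sk) e1 ey)

precedes-< : (c v r' c' w : ℕ) → w < v → precedes c v (r' , c' , w) ≡ true
precedes-< c v r' c' w lt rewrite <⇒<ᵇ-true w v lt = refl

precedes-> : (c v r' c' w : ℕ) → v < w → precedes c v (r' , c' , w) ≡ false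
precedes-> c v r' c' w gt rewrite ≮⇒<ᵇ-false w v (λ q → <-asym q gt) | ≢⇒≡ᵇ-false w v (λ q → <-irrefl (sym q) gt) = refl

precedes-left : (c v r' c' : ℕ) → c' < c → precedes c v (r' , c' , v) ≡ true
precedes-left c v r' c' lt rewrite ≮⇒<ᵇ-false v v (<-irrefl refl) | ≡ᵇ-refl v | <⇒<ᵇ-true c' c lt = refl

precedes-notLeft : (c v r' c' : ℕ) → ¬ (c' < c) → precedes c v (r' , c' , v) ≡ false
precedes-notLeft c v r' c' nlt rewrite ≮⇒<ᵇ-false v v (<-irrefl refl) | ≡ᵇ-refl v | ≮⇒<ᵇ-false c' c nlt = refl

-- The source
mapV : (ℕ → ℕ) → Cell → Cell
mapV f (r , c , x) = (r , c , f x)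

rowCells-map : (f : ℕ → ℕ) (r c : ℕ) (row : List ℕ) → rowCells r c (map f row) ≡ map (mapV f) (rowCells r c row)
rowCells-map f r c [] = refl
rowCells-map f r c (x ∷ row) = cong ((r , c , f x) ∷_) (rowCells-map f r (suc c) row)

cellsFrom-map : (f : ℕ → ℕ) (r : ℕ) (T : Tableau) → cellsFrom r (map (map f) T) ≡ map (mapV f) (cellsFrom r T)
cellsFrom-map f r [] = refl
cellsFrom-map f r (row ∷ T) = trans (cong₂ _++_ (rowCells-map f r 0 row) (cellsFrom-map f (suc r) T)) (sym (map-++ (mapV f) (rowCells r 0 row) (cellsFrom (suc r) T)))

shape-map : (f : ℕ → ℕ) (T : Tableau) → shape (map (map f) T) ≡ shape T
shape-map f [] = refl
shape-map f (row ∷ T) = cong₂ _∷_ (length-map f row) (shape-map f T)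

length-stdRow : (cs : List Cell) (k : ℕ) (row : List ℕ) → length (stdRow cs k row) ≡ length row
length-stdRow cs k [] = refl
length-stdRow cs k (x ∷ row) = cong suc (length-stdRow cs (suc k) row)

shape-std : (T : Tableau) → shape (std T) ≡ shape T
shape-std T = lengths T
  where
  lengths : (L : Tableau) → map length (map (stdRow (cells T) 0) L) ≡ map length L
  lengths [] = refl
  lengths (row ∷ L) = cong₂ _∷_ (length-stdRow (cells T) 0 row) (lengths L)

module Source (S : Tableau) (stdS : IsStandard S) where
  open Descents S stdS

  source : Tableau
  source = Tα α S

  entry-source : (r c : ℕ) → entry source r c ≡ M.map (label α) (entry S r c)
  entry-source r c = entry-map (label α) S r c

  entry-source⁻ : (r c x : ℕ) → entry source r c ≡ just x → ∃ λ s → entry S r c ≡ just s × label α s ≡ x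
  entry-source⁻ r c x e with entry S r c in es | entry-source r c
  ... | just s | eq = s , refl , just-injective (trans (sym eq) e)
  ... | nothing | eq with trans (sym eq) e
  ...   | ()

  source-isTableau : IsTableau source
  source-isTableau = subst Partition (sym (shape-map (label α) S)) (proj₁ tabS) , rowW , colSt
    where
    rowW : ∀ r c x y → entry source r c ≡ just x → entry source r (suc c) ≡ just y → x ≤ y
    rowW r c x y ex ey with entry-source⁻ r c x ex | entry-source⁻ r (suc c) y ey
    ... | s , e1 , refl | t , e2 , refl = label-mono α s t (proj₁ (proj₂ tabS) r c s t e1 e2)
    colSt : ∀ r c x y → entry source r c ≡ just x → entry source (suc r) c ≡ just y → x < y
    colSt r c x y ex ey with entry-source⁻ r c x ex | entry-source⁻ (suc r) c y ey
    ... | s , e1 , refl | t , e2 , refl with m≤n⇒m<n∨m≡n (label-mono α s t (<⇒≤ (proj₂ (proj₂ tabS) r c s t e1 e2)))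
    ... | inj₁ lt = lt
    ... | inj₂ eq = ⊥-elim (<-irrefl refl (proj₂ (sameLabel-position s t r c (suc r) c e1 e2 (proj₂ (proj₂ tabS) r c s t e1 e2) eq)))

  precedes-label : (r c s r' c' v : ℕ) → entry S r c ≡ just s → entry S r' c' ≡ just v →
    precedes c (label α s) (r' , c' , label α v) ≡ (v <ᵇ s)
  precedes-label r c s r' c' v es ev with <-cmp v s
  ... | tri≈ _ refl _ with position-unique r c r' c' v es ev
  ...   | refl , refl rewrite ≮⇒<ᵇ-false (label α v) (label α v) (<-irrefl refl) | ≡ᵇ-refl (label α v) | ≮⇒<ᵇ-false c c (<-irrefl refl) | ≮⇒<ᵇ-false v v (<-irrefl refl) = refl
  precedes-label r c s r' c' v es ev | tri< lt _ _ rewrite <⇒<ᵇ-true v s lt with m≤n⇒m<n∨m≡n (label-mono α v s (<⇒≤ lt))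
  ... | inj₁ llt rewrite <⇒<ᵇ-true (label α v) (label α s) llt = refl
  ... | inj₂ leq rewrite leq | ≮⇒<ᵇ-false (label α s) (label α s) (<-irrefl refl) | ≡ᵇ-refl (label α s) | <⇒<ᵇ-true c' c (proj₂ (sameLabel-position v s r' c' r c ev es lt leq)) = refl
  precedes-label r c s r' c' v es ev | tri> _ _ gt rewrite ≮⇒<ᵇ-false v s (λ q → <-asym q gt) | ≮⇒<ᵇ-false (label α v) (label α s) (λ q → <-irrefl refl (≤-trans q (label-mono α s v (<⇒≤ gt)))) with m≤n⇒m<n∨m≡n (label-mono α s v (<⇒≤ gt))
  ... | inj₁ llt rewrite ≢⇒≡ᵇ-false (label α v) (label α s) (λ q → <-irrefl (sym q) llt) = refl
  ... | inj₂ leq rewrite leq | ≡ᵇ-refl (label α v) | ≮⇒<ᵇ-false c' c (λ q → <-asym q (proj₂ (sameLabel-position s v r c r' c' es ev gt leq))) = refl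

  stdValue-source : (r c s : ℕ) → entry S r c ≡ just s → stdValue source c (label α s) ≡ s
  stdValue-source r c s es = begin
    suc (count (precedes c (label α s)) (cells source)) ≡⟨ cong (λ z → suc (count (precedes c (label α s)) z)) (cellsFrom-map (label α) 0 S) ⟩
    suc (count (precedes c (label α s)) (map (mapV (label α)) (cells S))) ≡⟨ cong suc (count-map (precedes c (label α s)) (mapV (label α)) (cells S)) ⟩
    suc (count (λ e → precedes c (label α s) (mapV (label α) e)) (cells S)) ≡⟨ cong suc (count-ext∈ _ (λ e → valE e <ᵇ s) (cells S) pt) ⟩
    suc (count (λ e → valE e <ᵇ s) (cells S)) ≡⟨ cong suc (count-cells-oneTo (λ y → y <ᵇ s)) ⟩
    suc (count (λ y → y <ᵇ s) (oneTo m)) ≡⟨ cong suc (count-oneTo-<ᵇ s m (m≤n⇒m≤1+n (proj₂ (val-range r c s es)))) ⟩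
    suc (s ∸ 1) ≡⟨ m+[n∸m]≡n (proj₁ (val-range r c s es)) ⟩
    s ∎
    where
    open ≡-Reasoning
    pt : ∀ e → e ∈ cells S → precedes c (label α s) (mapV (label α) e) ≡ (valE e <ᵇ s)
    pt (r' , c' , v) mem = precedes-label r c s r' c' v es (cells-mem S r' c' v mem)

  std-source : std source ≡ S
  std-source = tab-ext (std source) S (trans (shape-std source) (shape-map (label α) S)) h
    where
    h : ∀ r c x → entry (std source) r c ≡ just x → entry S r c ≡ just x
    h r c x e with entry S r c in es
    ... | nothing = ⊥-elim (nj (trans (sym e) (trans (entry-std source r c) (cong (M.map (stdValue source c)) (trans (entry-source r c) (cong (M.map (label α)) es))))))
      where
      nj : ∀ {z : ℕ} → just z ≡ nothing → ⊥
      nj ()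
    ... | just s = cong just (trans (sym (stdValue-source r c s es)) (just-injective (trans (sym (trans (entry-std source r c) (cong (M.map (stdValue source c)) (trans (entry-source r c) (cong (M.map (label α)) es))))) e)))

  source∈V : (n : ℕ) → length α ≤ n → InV n S source
  source∈V n hL = (shape-map (label α) S , source-isTableau , rng) , std-source
    where
    rng : ∀ r c x → entry source r c ≡ just x → 1 ≤ x × x ≤ n
    rng r c x e with entry-source⁻ r c x e
    ... | s , es , refl = label≥1 α s , ≤-trans (label-α≤length s (proj₁ (val-range r c s es)) (proj₂ (val-range r c s es))) hL

∧-true : (a b : Bool) → (a ∧ b) ≡ true → a ≡ true × b ≡ true
∧-true true true e = refl , refl

∧-intro : (a b : Bool) → a ≡ true → b ≡ true → (a ∧ b) ≡ true
∧-intro true true refl refl = refl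

count-mono-row : (Q : ℕ → Bool) (rx ry : List ℕ) → length rx ≡ length ry →
  (∀ c x y → nth rx c ≡ just x → nth ry c ≡ just y → Q x ≡ true → Q y ≡ true) → count Q rx ≤ count Q ry
count-mono-row Q [] [] l h = z≤n
count-mono-row Q (x ∷ rx) (y ∷ ry) l h with Q x in e1 | Q y in e2
... | true | true = s≤s (count-mono-row Q rx ry (suc-injective l) (λ c a b p q → h (suc c) a b p q))
... | true | false = ⊥-elim (true≢false (trans (sym (h 0 x y refl refl e1)) e2))
... | false | true = m≤n⇒m≤1+n (count-mono-row Q rx ry (suc-injective l) (λ c a b p q → h (suc c) a b p q))
... | false | false = count-mono-row Q rx ry (suc-injective l) (λ c a b p q → h (suc c) a b p q)

countEntries-mono : (Q : ℕ → Bool) (X Y : Tableau) → shape X ≡ shape Y →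
  (∀ r c x y → entry X r c ≡ just x → entry Y r c ≡ just y → Q x ≡ true → Q y ≡ true) → countEntries Q X ≤ countEntries Q Y
countEntries-mono Q [] [] s h = z≤n
countEntries-mono Q (rx ∷ X) (ry ∷ Y) s h =
  subst₂ _≤_ (sym (count-concat-cons Q rx X)) (sym (count-concat-cons Q ry Y))
    (+-mono-≤ (count-mono-row Q rx ry (hd s) (λ c a b p q → h 0 c a b p q)) (countEntries-mono Q X Y (tl s) (λ r c a b p q → h (suc r) c a b p q)))
  where
  hd : ∀ {p q : ℕ} {ps qs} → _≡_ {A = List ℕ} (p ∷ ps) (q ∷ qs) → p ≡ q
  hd refl = refl
  tl : ∀ {p q : ℕ} {ps qs} → _≡_ {A = List ℕ} (p ∷ ps) (q ∷ qs) → ps ≡ qs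
  tl refl = refl

between : ℕ → ℕ → ℕ → Bool
between a b x = (a ≤ᵇ x) ∧ (x ≤ᵇ b)

countEntries-fTab-between : (i n : ℕ) (E T : Tableau) → i < n → fTab i E ≡ just T →
  countEntries (between (suc i) n) T ≡ countEntries (between (suc i) n) E + 1
countEntries-fTab-between i n E T i<n step = begin
  countEntries P T ≡⟨ sym (+-identityʳ _) ⟩
  countEntries P T + bit false ≡⟨ cong (λ b → countEntries P T + bit b) (sym P[i]) ⟩
  countEntries P T + bit (P i) ≡⟨ countEntries-fTab P i E T step ⟩
  countEntries P E + bit (P (suc i)) ≡⟨ cong (λ b → countEntries P E + bit b) P[1+i] ⟩
  countEntries P E + 1 ∎
  where
  open ≡-Reasoning
  P : ℕ → Bool
  P = between (suc i) n
  P[i] : P i ≡ false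
  P[i] rewrite ≰⇒≤ᵇ-false (suc i) i 1+n≰n = refl
  P[1+i] : P (suc i) ≡ true
  P[1+i] rewrite ≤⇒≤ᵇ-true (suc i) (suc i) ≤-refl | ≤⇒≤ᵇ-true (suc i) n i<n = refl

evac-source-isSink : (n : ℕ) (S S' : Tableau) → IsStandard S → length (desComp S) ≤ n →
  (∀ T → InV n S T → InV n S' (EVAC n T)) →
  (∀ T' → InV n S' T' → ∃ λ T → InV n S T × EVAC n T ≡ T') →
  IsSink n S' (EVAC n (Tα (desComp S) S))
evac-source-isSink n S S' stdS hL evac-V evac-V⁻ = evac-V source (source∈V n hL) , no-step
  where
  open Source S stdS
  open Descents S stdS using (α)
  no-step : ∀ i T' → 1 ≤ i → i < n → fTab i (EVAC n source) ≡ just T' → ¬ InV n S' T'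
  no-step i T' _ i<n step T'∈V with evac-V⁻ T' T'∈V
  ... | T , ((shT , tabT , rngT) , stdT) , refl =
    1+n≰n (≤-trans (≤-reflexive (trans (+-comm 1 _) (sym more))) fewer)
    where
    open Standardizes S stdS T shT tabT stdT using (label-α≤entry)
    P : ℕ → Bool
    P = between (suc i) n
    Q : ℕ → Bool
    Q x = P (suc n ∸ x)
    more : countEntries Q T ≡ countEntries Q source + 1
    more = begin
      countEntries Q T ≡⟨ sym (countEntries-EVAC P refl n T) ⟩
      countEntries P (EVAC n T) ≡⟨ countEntries-fTab-between i n (EVAC n source) (EVAC n T) i<n step ⟩
      countEntries P (EVAC n source) + 1 ≡⟨ cong (_+ 1) (countEntries-EVAC P refl n source) ⟩
      countEntries Q source + 1 ∎
      where open ≡-Reasoning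
    below-source : ∀ r c x y → entry T r c ≡ just x → entry source r c ≡ just y → Q x ≡ true → Q y ≡ true
    below-source r c x y ex ey Qx with entry-source⁻ r c y ey
    ... | s , es , refl = ∧-intro _ _
      (≤⇒≤ᵇ-true (suc i) _ (≤-trans (≤ᵇ-true⇒≤ _ _ (proj₁ (∧-true _ _ Qx))) (∸-monoʳ-≤ (suc n) (label-α≤entry (λ r c x e → proj₁ (rngT r c x e)) s r c x es ex))))
      (≤⇒≤ᵇ-true _ n (∸-monoʳ-≤ (suc n) (label≥1 α s)))
    fewer : countEntries Q T ≤ countEntries Q source
    fewer = countEntries-mono Q T source (trans shT (sym (shape-map (label α) S))) below-source

-- The sink
module Sink (n : ℕ) (S : Tableau) (stdS : IsStandard S) (hL : length (desComp S) ≤ n) (T : Tableau) (sinkT : IsSink n S T) where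
  shT : shape T ≡ shape S
  shT = proj₁ (proj₁ (proj₁ sinkT))
  tabT : IsTableau T
  tabT = proj₁ (proj₂ (proj₁ (proj₁ sinkT)))
  rngT : ∀ r c x → entry T r c ≡ just x → 1 ≤ x × x ≤ n
  rngT = proj₂ (proj₂ (proj₁ (proj₁ sinkT)))
  stdT : std T ≡ S
  stdT = proj₂ (proj₁ sinkT)
  open Standardizes S stdS T shT tabT stdT public

  L : ℕ
  L = length α

  shift : ℕ → ℕ
  shift s = (n ∸ L) + label α s

  Settled : ℕ → Set
  Settled s = ∀ r c x → entry S r c ≡ just s → entry T r c ≡ just x → x ≡ shift s

  SettledAbove : ℕ → Set
  SettledAbove s = ∀ t → s < t → Settled t

  entry≤shift : (s r c x : ℕ) → entry S r c ≡ just s → entry T r c ≡ just x → x ≤ shift s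
  entry≤shift s r c x es ex = entry≤shiftedLabel n hL (λ r c x e → proj₂ (rngT r c x e)) (m ∸ s) s r c x (m+[n∸m]≡n (proj₂ (val-range r c s es))) es ex

  shift≤n : (s r c : ℕ) → entry S r c ≡ just s → shift s ≤ n
  shift≤n s r c es = ≤-trans (+-monoʳ-≤ (n ∸ L) (label-α≤length s (proj₁ (val-range r c s es)) (proj₂ (val-range r c s es)))) (≤-reflexive (m∸n+n≡m hL))

  -- An entry x below its bound whose larger standard values all sit at their bound
  -- is the rightmost unmatched letter x of the reading word, and raising it keeps
  -- the tableau semistandard with the same standardization.
  module Raise (s : ℕ) (ab : SettledAbove s) (r c x : ℕ) (es : entry S r c ≡ just s) (ex : entry T r c ≡ just x) (lt : x < shift s) where
    equal-left : (r' c' : ℕ) → entry T r' c' ≡ just x → ¬ (r' ≡ r × c' ≡ c) → c' < c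
    equal-left r' c' ex' ne with entry-std-just r' c' x ex'
    ... | et with <-cmp (stdValue T c' x) s
    ...   | tri< a _ _ = sameEntry-col< r' c' x (stdValue T c' x) r c s ex' et ex es a
    ...   | tri≈ _ eq _ = ⊥-elim (ne (position-unique r' c' r c s (trans et (cong just eq)) es))
    ...   | tri> _ _ gt = ⊥-elim (<-irrefl refl (<-≤-trans lt (≤-trans (+-monoʳ-≤ (n ∸ L) (label-mono α s _ (<⇒≤ gt))) (≤-reflexive (sym (ab _ gt r' c' x et ex'))))))

    successor-position : (r' c' : ℕ) → entry T r' c' ≡ just (suc x) → r' ≤ r × c < c'
    successor-position r' c' ey = rr , ≰⇒> (λ q → 1+n≰n (rect≤ T tabT r' c' r c rr q ey ex))
      where
      t : ℕ
      t = stdValue T c' (suc x)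
      et : entry S r' c' ≡ just t
      et = entry-std-just r' c' (suc x) ey
      st : s < t
      st = <⇒std< r c x s r' c' (suc x) t ex es ey et ≤-refl
      ut : suc x ≡ shift t
      ut = ab t st r' c' (suc x) et ey
      leq : label α s ≡ label α t
      leq = ≤-antisym (label-mono α s t (<⇒≤ st)) (+-cancelˡ-≤ (n ∸ L) _ _ (≤-trans (≤-reflexive (sym ut)) lt))
      rr : r' ≤ r
      rr = proj₁ (sameLabel-position s t r c r' c' es et st leq)

    no-successor-below : ∀ r' c' z → r < r' → entry T r' c' ≡ just z → z ≢ suc x
    no-successor-below r' c' z lt' ez refl = 1+n≰n (≤-trans lt' (proj₁ (successor-position r' c' ez)))
    no-successor-left : ∀ c' z → c' < c → entry T r c' ≡ just z → z ≢ suc x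
    no-successor-left c' z lt' ez refl = 1+n≰n (row-mono' T tabT r c' c (<⇒≤ lt') ez ex)
    no-equal-right : ∀ c' z → c < c' → entry T r c' ≡ just z → z ≢ x
    no-equal-right c' z lt' ez refl = <-asym lt' (equal-left r c' ez (λ { (_ , q) → <-irrefl (sym q) lt' }))
    no-equal-above : ∀ r' c' z → r' < r → entry T r' c' ≡ just z → z ≢ x
    no-equal-above r' c' z lt' ez refl = <-irrefl refl (rect< T tabT r' c' r c lt' (<⇒≤ (equal-left r' c' ez (λ { (q , _) → <-irrefl q lt' }))) ez ex)

    raised : Tableau
    raised = setEntry r c (suc x) T

    f-raise : fTab x T ≡ just raised
    f-raise = fTab-setEntry x T r c ex no-successor-below no-successor-left no-equal-right no-equal-above

    entry-raised : (r1 c1 v : ℕ) → entry raised r1 c1 ≡ just v → ((r1 ≡ r × c1 ≡ c) × v ≡ suc x) ⊎ (¬ (r1 ≡ r × c1 ≡ c) × entry T r1 c1 ≡ just v)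
    entry-raised r1 c1 v e with r1 ≟ r | c1 ≟ c
    ... | yes refl | yes refl = inj₁ ((refl , refl) , just-injective (trans (sym e) (entry-setEntry-same r c (suc x) T ex)))
    ... | no ne | _ = inj₂ ((λ q → ne (proj₁ q)) , trans (sym (entry-setEntry-other r c (suc x) T r1 c1 (λ q → ne (sym (proj₁ q))))) e)
    ... | yes refl | no ne = inj₂ ((λ q → ne (proj₂ q)) , trans (sym (entry-setEntry-other r c (suc x) T r c1 (λ q → ne (sym (proj₂ q))))) e)

    rowWT : ∀ r c x y → entry T r c ≡ just x → entry T r (suc c) ≡ just y → x ≤ y
    rowWT = proj₁ (proj₂ tabT)
    colST : ∀ r c x y → entry T r c ≡ just x → entry T (suc r) c ≡ just y → x < y
    colST = proj₂ (proj₂ tabT)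

    raised-isTableau : IsTableau raised
    raised-isTableau = subst Partition (sym (shape-setEntry r c (suc x) T)) (proj₁ tabT) , raised-rows , raised-columns
      where
      raised-rows : ∀ r1 c1 v1 v2 → entry raised r1 c1 ≡ just v1 → entry raised r1 (suc c1) ≡ just v2 → v1 ≤ v2
      raised-rows r1 c1 v1 v2 e1 e2 with entry-raised r1 c1 v1 e1 | entry-raised r1 (suc c1) v2 e2
      ... | inj₁ ((refl , refl) , refl) | inj₁ ((_ , q) , _) = ⊥-elim (1+n≰n (≤-reflexive q))
      ... | inj₁ ((refl , refl) , refl) | inj₂ (_ , o2) with m≤n⇒m<n∨m≡n (rowWT r c x v2 ex o2)
      ...   | inj₁ a = a
      ...   | inj₂ q = ⊥-elim (no-equal-right (suc c) v2 ≤-refl o2 (sym q))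
      raised-rows r1 c1 v1 v2 e1 e2 | inj₂ (_ , o1) | inj₁ ((refl , refl) , refl) = m≤n⇒m≤1+n (rowWT r c1 v1 x o1 ex)
      raised-rows r1 c1 v1 v2 e1 e2 | inj₂ (_ , o1) | inj₂ (_ , o2) = rowWT r1 c1 v1 v2 o1 o2
      raised-columns : ∀ r1 c1 v1 v2 → entry raised r1 c1 ≡ just v1 → entry raised (suc r1) c1 ≡ just v2 → v1 < v2
      raised-columns r1 c1 v1 v2 e1 e2 with entry-raised r1 c1 v1 e1 | entry-raised (suc r1) c1 v2 e2
      ... | inj₁ ((refl , refl) , refl) | inj₁ ((q , _) , _) = ⊥-elim (1+n≰n (≤-reflexive q))
      ... | inj₁ ((refl , refl) , refl) | inj₂ (_ , o2) with m≤n⇒m<n∨m≡n (colST r c x v2 ex o2)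
      ...   | inj₁ a = a
      ...   | inj₂ q = ⊥-elim (no-successor-below (suc r) c v2 ≤-refl o2 (sym q))
      raised-columns r1 c1 v1 v2 e1 e2 | inj₂ (_ , o1) | inj₁ ((refl , refl) , refl) = m≤n⇒m≤1+n (colST r1 c v1 x o1 ex)
      raised-columns r1 c1 v1 v2 e1 e2 | inj₂ (_ , o1) | inj₂ (_ , o2) = colST r1 c1 v1 v2 o1 o2

    raised-bounded : ∀ r1 c1 v → entry raised r1 c1 ≡ just v → 1 ≤ v × v ≤ n
    raised-bounded r1 c1 v e with entry-raised r1 c1 v e
    ... | inj₁ (_ , refl) = s≤s z≤n , ≤-trans lt (shift≤n s r c es)
    ... | inj₂ (_ , o) = rngT r1 c1 v o

    stdValue-raised-other : (r1 c1 v : ℕ) → ¬ (r1 ≡ r × c1 ≡ c) → entry T r1 c1 ≡ just v → stdValue raised c1 v ≡ stdValue T c1 v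
    stdValue-raised-other r1 c1 v ne ev = cong suc (+-cancelʳ-≡′ (count-setEntry (precedes c1 v) T r c x (suc x) ex) same)
      where
      +-cancelʳ-≡′ : ∀ {a b d e} → a + d ≡ b + e → d ≡ e → a ≡ b
      +-cancelʳ-≡′ {a} {b} {d} eq refl = +-cancelʳ-≡ d a b eq
      same : bit (precedes c1 v (r , c , x)) ≡ bit (precedes c1 v (r , c , suc x))
      same = cong bit same'
        where
        same' : precedes c1 v (r , c , x) ≡ precedes c1 v (r , c , suc x)
        same' with <-cmp v x
        ... | tri< a _ _ = trans (precedes-> c1 v r c x a) (sym (precedes-> c1 v r c (suc x) (<-trans a (n<1+n x))))
        ... | tri≈ _ refl _ = trans (precedes-notLeft c1 v r c (λ q → <-asym q (equal-left r1 c1 ev ne))) (sym (precedes-> c1 v r c (suc v) (n<1+n v)))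
        ... | tri> _ _ gt with m≤n⇒m<n∨m≡n gt
        ...   | inj₁ gt2 = trans (precedes-< c1 v r c x gt) (sym (precedes-< c1 v r c (suc x) gt2))
        ...   | inj₂ refl = trans (precedes-< c1 (suc x) r c x (n<1+n x)) (sym (precedes-left c1 (suc x) r c (proj₂ (successor-position r1 c1 ev))))

    stdValue-raised : stdValue raised c (suc x) ≡ stdValue T c x
    stdValue-raised = cong suc (+-cancelʳ-≡ 1 _ _ (trans p-raised p-vs-q-at))
      where
      p : Cell → Bool
      p = precedes c (suc x)
      q : Cell → Bool
      q = precedes c x
      p-old : p (r , c , x) ≡ true
      p-old rewrite <⇒<ᵇ-true x (suc x) ≤-refl = refl
      p-new : p (r , c , suc x) ≡ false
      p-new rewrite ≮⇒<ᵇ-false (suc x) (suc x) (<-irrefl refl) | ≡ᵇ-refl (suc x) | ≮⇒<ᵇ-false c c (<-irrefl refl) = refl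
      q-old : q (r , c , x) ≡ false
      q-old rewrite ≮⇒<ᵇ-false x x (<-irrefl refl) | ≡ᵇ-refl x | ≮⇒<ᵇ-false c c (<-irrefl refl) = refl
      p-setEntry : count p (cells raised) + bit (p (r , c , x)) ≡ count p (cells T) + bit (p (r , c , suc x))
      p-setEntry = count-setEntry p T r c x (suc x) ex
      p-raised : count p (cells raised) + 1 ≡ count p (cells T) + 0
      p-raised = subst₂ (λ p-vs-q-at b2 → count p (cells raised) + bit p-vs-q-at ≡ count p (cells T) + bit b2) p-old p-new p-setEntry
      agree : ∀ e → e ∈ cells T → OffPos r c e → p e ≡ q e
      agree (r' , c' , w) mem off with <-cmp w x
      ... | tri< a _ _ = trans (precedes-< c (suc x) r' c' w (<-trans a (n<1+n x))) (sym (precedes-< c x r' c' w a))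
      ... | tri≈ _ refl _ = trans (precedes-< c (suc w) r' c' w (n<1+n w)) (sym (precedes-left c w r' c' (equal-left r' c' (cells-mem T r' c' w mem) (λ { (q1 , q2) → off (q1 , q2) }))))
      ... | tri> _ _ gt with m≤n⇒m<n∨m≡n gt
      ...   | inj₁ gt2 = trans (precedes-> c (suc x) r' c' w gt2) (sym (precedes-> c x r' c' w gt))
      ...   | inj₂ refl = trans (precedes-notLeft c (suc x) r' c' (λ z → <-asym z (proj₂ (successor-position r' c' (cells-mem T r' c' (suc x) mem))))) (sym (precedes-> c x r' c' (suc x) (n<1+n x)))
      p-vs-q : count p (cells T) + bit (q (r , c , x)) ≡ count q (cells T) + bit (p (r , c , x))
      p-vs-q = count-offpos p q T r c x ex agree
      p-vs-q-at : count p (cells T) + 0 ≡ count q (cells T) + 1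
      p-vs-q-at = subst₂ (λ p-vs-q-at b2 → count p (cells T) + bit p-vs-q-at ≡ count q (cells T) + bit b2) q-old p-old p-vs-q

    std-raised : std raised ≡ S
    std-raised = tab-ext (std raised) S (trans (shape-std raised) (trans (shape-setEntry r c (suc x) T) shT)) h
      where
      h : ∀ r1 c1 w → entry (std raised) r1 c1 ≡ just w → entry S r1 c1 ≡ just w
      h r1 c1 w e with entry raised r1 c1 in e2 | entry-std raised r1 c1
      ... | nothing | eq with trans (sym e) eq
      ...   | ()
      h r1 c1 w e | just v | eq with trans (sym e) eq
      ...   | refl with entry-raised r1 c1 v e2
      ...     | inj₁ ((refl , refl) , refl) = trans (entry-std-just r c x ex) (cong just (sym stdValue-raised))
      ...     | inj₂ (ne , o) = trans (entry-std-just r1 c1 v o) (cong just (sym (stdValue-raised-other r1 c1 v ne o)))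

    sink-violated : ⊥
    sink-violated = proj₂ sinkT x raised (proj₁ (rngT r c x ex)) (<-≤-trans lt (shift≤n s r c es)) f-raise ((trans (shape-setEntry r c (suc x) T) shT , raised-isTableau , raised-bounded) , std-raised)

  settled-step : (s : ℕ) → SettledAbove s → Settled s
  settled-step s ab r c x es ex with m≤n⇒m<n∨m≡n (entry≤shift s r c x es ex)
  ... | inj₂ eq = eq
  ... | inj₁ lt = ⊥-elim (Raise.sink-violated s ab r c x es ex lt)

  settledAbove : (k s : ℕ) → s + k ≡ m → SettledAbove s
  settledAbove zero s sk t lt r c x et ex = ⊥-elim (1+n≰n (≤-trans lt (≤-trans (proj₂ (val-range r c t et)) (≤-reflexive (trans (sym sk) (+-identityʳ s))))))
  settledAbove (suc k) s sk t lt with m≤n⇒m<n∨m≡n lt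
  ... | inj₁ lt2 = settledAbove k (suc s) (trans (sym (+-suc s k)) sk) t lt2
  ... | inj₂ refl = settled-step (suc s) (settledAbove k (suc s) (trans (sym (+-suc s k)) sk))

  sink-entry≡shift : (s r c x : ℕ) → entry S r c ≡ just s → entry T r c ≡ just x → x ≡ shift s
  sink-entry≡shift s r c x es ex = settled-step s (settledAbove (m ∸ s) s (m+[n∸m]≡n (proj₂ (val-range r c s es)))) r c x es ex

  sink≡shiftedSource : T ≡ map (map shift) S
  sink≡shiftedSource = tab-ext T (map (map shift) S) (trans shT (sym (shape-map shift S))) h
    where
    h : ∀ r c x → entry T r c ≡ just x → entry (map (map shift) S) r c ≡ just x
    h r c x e with entry-std-just r c x e
    ... | es = trans (entry-map shift S r c) (trans (cong (M.map shift) es) (cong just (sym (sink-entry≡shift _ r c x es e))))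

oneTo-+ : (a b : ℕ) → oneTo (a + b) ≡ oneTo a ++ map (a +_) (oneTo b)
oneTo-+ a zero rewrite +-identityʳ a = sym (++-identityʳ (oneTo a))
oneTo-+ a (suc b) rewrite +-suc a b = begin
  oneTo (suc (a + b)) ≡⟨ oneTo-snoc (a + b) ⟩
  oneTo (a + b) ++ suc (a + b) ∷ [] ≡⟨ cong (_++ suc (a + b) ∷ []) (oneTo-+ a b) ⟩
  (oneTo a ++ map (a +_) (oneTo b)) ++ suc (a + b) ∷ [] ≡⟨ ++-assoc (oneTo a) _ _ ⟩
  oneTo a ++ (map (a +_) (oneTo b) ++ suc (a + b) ∷ []) ≡⟨ cong (λ z → oneTo a ++ (map (a +_) (oneTo b) ++ z ∷ [])) (sym (+-suc a b)) ⟩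
  oneTo a ++ (map (a +_) (oneTo b) ++ map (a +_) (suc b ∷ [])) ≡⟨ cong (oneTo a ++_) (sym (map-++ (a +_) (oneTo b) (suc b ∷ []))) ⟩
  oneTo a ++ map (a +_) (oneTo b ++ suc b ∷ []) ≡⟨ cong (λ z → oneTo a ++ map (a +_) z) (sym (oneTo-snoc b)) ⟩
  oneTo a ++ map (a +_) (oneTo (suc b)) ∎
  where open ≡-Reasoning

length-oneTo : (k : ℕ) → length (oneTo k) ≡ k
length-oneTo k = trans (length-map suc (upTo k)) (length-upTo k)

count-label> : (k : ℕ) (β : List ℕ) → count (λ x → k <ᵇ label β x) (oneTo (sum β)) ≡ sum (drop k β)
count-label> zero [] = refl
count-label> (suc k) [] = refl
count-label> k (a ∷ β) = begin
  count (λ x → k <ᵇ label (a ∷ β) x) (oneTo (a + sum β)) ≡⟨ cong (count (λ x → k <ᵇ label (a ∷ β) x)) (oneTo-+ a (sum β)) ⟩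
  count (λ x → k <ᵇ label (a ∷ β) x) (oneTo a ++ map (a +_) (oneTo (sum β))) ≡⟨ count-++ _ (oneTo a) _ ⟩
  count (λ x → k <ᵇ label (a ∷ β) x) (oneTo a) + count (λ x → k <ᵇ label (a ∷ β) x) (map (a +_) (oneTo (sum β))) ≡⟨ cong₂ _+_ first-part (trans (count-map _ (a +_) (oneTo (sum β))) later-parts) ⟩
  (if k ≡ᵇ 0 then a else 0) + count (λ y → k <ᵇ suc (label β y)) (oneTo (sum β)) ≡⟨ combine k ⟩
  sum (drop k (a ∷ β)) ∎
  where
  open ≡-Reasoning
  first-part : count (λ x → k <ᵇ label (a ∷ β) x) (oneTo a) ≡ (if k ≡ᵇ 0 then a else 0)
  first-part = trans (count-ext∈ _ (λ x → k <ᵇ 1) (oneTo a) pt) (count-first k)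
    where
    pt : ∀ x → x ∈ oneTo a → (k <ᵇ label (a ∷ β) x) ≡ (k <ᵇ 1)
    pt x mem rewrite ≤⇒≤ᵇ-true x a (proj₂ (All.lookup (oneTo-range a) mem)) = refl
    count-first : (k : ℕ) → count (λ x → k <ᵇ 1) (oneTo a) ≡ (if k ≡ᵇ 0 then a else 0)
    count-first zero = trans (count-true _ (oneTo a) (λ _ _ → refl)) (length-oneTo a)
    count-first (suc k) = count-false _ (oneTo a) (λ _ _ → refl)
  later-parts : count (λ y → k <ᵇ label (a ∷ β) (a + y)) (oneTo (sum β)) ≡ count (λ y → k <ᵇ suc (label β y)) (oneTo (sum β))
  later-parts = count-ext∈ _ _ (oneTo (sum β)) pt
    where
    pt : ∀ y → y ∈ oneTo (sum β) → (k <ᵇ label (a ∷ β) (a + y)) ≡ (k <ᵇ suc (label β y))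
    pt y mem rewrite ≰⇒≤ᵇ-false (a + y) a (λ q → 1+n≰n (≤-trans (≤-trans (≤-reflexive (+-comm 1 a)) (+-monoʳ-≤ a (proj₁ (All.lookup (oneTo-range (sum β)) mem)))) q)) | m+n∸m≡n a y = refl
  combine : (k : ℕ) → (if k ≡ᵇ 0 then a else 0) + count (λ y → k <ᵇ suc (label β y)) (oneTo (sum β)) ≡ sum (drop k (a ∷ β))
  combine zero = cong (a +_) (trans (count-true _ (oneTo (sum β)) (λ _ _ → refl)) (length-oneTo (sum β)))
  combine (suc k) = count-label> k β

label-interval : (β : List ℕ) (v y : ℕ) → 1 ≤ v → sum (take (v ∸ 1) β) < y → y ≤ sum (take v β) → label β y ≡ v
label-interval [] v y hv h1 h2 = ⊥-elim (1+n≰n (≤-trans (subst (_< y) (sum-take-[] (v ∸ 1)) h1) (subst (y ≤_) (sum-take-[] v) h2)))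
  where
  sum-take-[] : (v : ℕ) → sum (take v []) ≡ 0
  sum-take-[] zero = refl
  sum-take-[] (suc v) = refl
label-interval (a ∷ β) (suc zero) y hv h1 h2 rewrite ≤⇒≤ᵇ-true y a (subst (y ≤_) (+-identityʳ a) h2) = refl
label-interval (a ∷ β) (suc (suc v)) y hv h1 h2 rewrite ≰⇒≤ᵇ-false y a (λ q → 1+n≰n (≤-trans (≤-trans (s≤s (m≤m+n a _)) h1) q)) =
  cong suc (label-interval β (suc v) (y ∸ a) (s≤s z≤n) shifted-lower shifted-upper)
  where
  shifted-lower : sum (take v β) < y ∸ a
  shifted-lower = subst (_< y ∸ a) (m+n∸m≡n a _) (∸-monoˡ-< h1 (m≤m+n a _))
  shifted-upper : y ∸ a ≤ sum (take (suc v) β)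
  shifted-upper = m≤n+o⇒m∸n≤o y a h2

sum-reverse : (xs : List ℕ) → sum (reverse xs) ≡ sum xs
sum-reverse xs = sum-↭ (↭-reverse xs)

take-exact : (xs ys : List ℕ) → take (length xs) (xs ++ ys) ≡ xs
take-exact [] ys = refl
take-exact (x ∷ xs) ys = cong (x ∷_) (take-exact xs ys)

sum-take-reverse : (α : List ℕ) (w : ℕ) → sum (take w (reverse α)) ≡ sum (drop (length α ∸ w) α)
sum-take-reverse α w with w ≤? length α
... | no gt rewrite take-all w (reverse α) (≤-trans (≤-reflexive (length-reverse α)) (<⇒≤ (≰⇒> gt))) | m≤n⇒m∸n≡0 (<⇒≤ (≰⇒> gt)) = sum-reverse α
... | yes le = trans (cong (λ z → sum (take w z)) eqr) (trans (cong sum tk) (sum-reverse (drop k α)))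
  where
  k : ℕ
  k = length α ∸ w
  eqr : reverse α ≡ reverse (drop k α) ++ reverse (take k α)
  eqr = trans (cong reverse (sym (take++drop≡id k α))) (reverse-++ (take k α) (drop k α))
  lenD : length (reverse (drop k α)) ≡ w
  lenD = trans (length-reverse (drop k α)) (trans (length-drop k α) (m∸[m∸n]≡n le))
  tk : take w (reverse (drop k α) ++ reverse (take k α)) ≡ reverse (drop k α)
  tk = subst (λ t → take t (reverse (drop k α) ++ reverse (take k α)) ≡ reverse (drop k α)) lenD (take-exact (reverse (drop k α)) _)

Bool-ext : (a b : Bool) → (a ≡ true → b ≡ true) → (b ≡ true → a ≡ true) → a ≡ b
Bool-ext true true f g = refl
Bool-ext true false f g = sym (f refl)
Bool-ext false true f g = g refl
Bool-ext false false f g = refl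

∸<-swap : (L a b : ℕ) → b ≤ L → L ∸ b < a → a ≤ L → L ∸ a < b
∸<-swap L a b hb h ha = subst (_≤ b) (+-∸-assoc 1 ha) (m≤n+o⇒m∸n≤o (suc L) a lt)
  where
  lt : suc L ≤ a + b
  lt = subst (λ t → suc t ≤ a + b) (m∸n+n≡m hb) (+-monoˡ-≤ b h)

between-1-complement : (L ℓ w : ℕ) → 1 ≤ ℓ → ℓ ≤ L → between 1 w (suc L ∸ ℓ) ≡ ((L ∸ w) <ᵇ ℓ)
between-1-complement L ℓ w h1 h2 rewrite +-∸-assoc 1 h2 = Bool-ext _ _ f g
  where
  f : ((L ∸ ℓ) <ᵇ w) ≡ true → ((L ∸ w) <ᵇ ℓ) ≡ true
  f e with w ≤? L
  ... | no gt rewrite m≤n⇒m∸n≡0 (<⇒≤ (≰⇒> gt)) = <⇒<ᵇ-true 0 ℓ h1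
  ... | yes le = <⇒<ᵇ-true _ ℓ (∸<-swap L w ℓ h2 (<ᵇ-true⇒< _ w e) le)
  g : ((L ∸ w) <ᵇ ℓ) ≡ true → ((L ∸ ℓ) <ᵇ w) ≡ true
  g e with w ≤? L
  ... | no gt = <⇒<ᵇ-true _ w (≤-<-trans (m∸n≤m L ℓ) (≰⇒> gt))
  ... | yes le = <⇒<ᵇ-true _ w (∸<-swap L ℓ w le (<ᵇ-true⇒< _ ℓ e) h2)

between-1-evac : (n L ℓ w : ℕ) → L ≤ n → 1 ≤ ℓ → ℓ ≤ L → between 1 w (suc n ∸ ((n ∸ L) + ℓ)) ≡ ((L ∸ w) <ᵇ ℓ)
between-1-evac n L ℓ w hL h1 h2 = trans (cong (between 1 w) shift-cancels) (between-1-complement L ℓ w h1 h2)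
  where
  shift-cancels : suc n ∸ ((n ∸ L) + ℓ) ≡ suc L ∸ ℓ
  shift-cancels = trans (cong (_∸ ((n ∸ L) + ℓ)) (trans (cong suc (sym (m∸n+n≡m hL))) (sym (+-suc (n ∸ L) L)))) ([m+n]∸[m+o]≡n∸o (n ∸ L) (suc L) ℓ)

-- The standard value of an entry v lies in (β₁ + … + β_{v-1}, β₁ + … + β_v].
weight⇒≡Tα-std : (β : List ℕ) (Y : Tableau) → (∀ r c x → entry Y r c ≡ just x → 1 ≤ x) →
  (∀ w → countEntries (between 1 w) Y ≡ sum (take w β)) → Y ≡ Tα β (std Y)
weight⇒≡Tα-std β Y pos weight = tab-ext Y (Tα β (std Y)) (sym (trans (shape-map (label β) (std Y)) (shape-std Y))) agree
  where
  agree : ∀ r c v → entry Y r c ≡ just v → entry (Tα β (std Y)) r c ≡ just v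
  agree r c v eY = trans (entry-map (label β) (std Y) r c) (trans (cong (M.map (label β)) eS) (cong just (label-interval β v y v1 lower upper)))
    where
    y : ℕ
    y = stdValue Y c v
    eS : entry (std Y) r c ≡ just y
    eS = trans (entry-std Y r c) (cong (M.map (stdValue Y c)) eY)
    v1 : 1 ≤ v
    v1 = pos r c v eY
    lower : sum (take (v ∸ 1) β) < y
    lower = s≤s (subst (_≤ count (precedes c v) (cells Y)) (trans (count-cells (between 1 (v ∸ 1)) Y) (weight (v ∸ 1)))
           (count-mono∈ (λ e → between 1 (v ∸ 1) (valE e)) (precedes c v) (cells Y) smaller-precedes))
      where
      smaller-precedes : ∀ e → e ∈ cells Y → between 1 (v ∸ 1) (valE e) ≡ true → precedes c v e ≡ true
      smaller-precedes (r' , c' , w) mem pe with (1 ≤ᵇ w) in e1 | (w ≤ᵇ v ∸ 1) in e2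
      smaller-precedes (r' , c' , w) mem refl | true | true rewrite <⇒<ᵇ-true w v (subst (suc w ≤_) (m+[n∸m]≡n v1) (s≤s (≤ᵇ-true⇒≤ w (v ∸ 1) e2))) = refl
    upper : y ≤ sum (take v β)
    upper = subst (y ≤_) (trans (count-cells (between 1 v) Y) (weight v))
           (count-strict∈ (precedes c v) (λ e → between 1 v (valE e)) (cells Y) precedes-≤ (r , c , v) (mem-cells Y r c v eY) pf pt)
      where
      precedes-≤ : ∀ e → e ∈ cells Y → precedes c v e ≡ true → between 1 v (valE e) ≡ true
      precedes-≤ (r' , c' , w) mem pe rewrite ≤⇒≤ᵇ-true 1 w (pos r' c' w (cells-mem Y r' c' w mem)) with w <ᵇ v in e1
      ... | true = ≤⇒≤ᵇ-true w v (<⇒≤ (<ᵇ-true⇒< w v e1))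
      ... | false with w ≡ᵇ v in e2
      ...   | true = ≤⇒≤ᵇ-true w v (≤-reflexive (≡ᵇ-true⇒≡ w v e2))
      ...   | false with pe
      ...     | ()
      pf : precedes c v (r , c , v) ≡ false
      pf rewrite ≮⇒<ᵇ-false v v (<-irrefl refl) | ≡ᵇ-refl v | ≮⇒<ᵇ-false c c (<-irrefl refl) = refl
      pt : between 1 v v ≡ true
      pt rewrite ≤⇒≤ᵇ-true 1 v v1 | ≤⇒≤ᵇ-true v v ≤-refl = refl

evac-sink≡source : (n : ℕ) (S S' : Tableau) → IsStandard S → length (desComp S) ≤ n →
  (∀ T → InV n S T → InV n S' (EVAC n T)) →
  ∀ T → IsSink n S T → EVAC n T ≡ Tα (reverse (desComp S)) S'
evac-sink≡source n S S' stdS hL evac-V T sinkT =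
  trans (weight⇒≡Tα-std (reverse α) Y (λ r c x e → proj₁ (proj₂ (proj₂ (proj₁ Y∈V)) r c x e)) evac-weight)
        (cong (Tα (reverse α)) (proj₂ Y∈V))
  where
  open Sink n S stdS hL T sinkT
  Y : Tableau
  Y = EVAC n T
  Y∈V : InV n S' Y
  Y∈V = evac-V T (proj₁ sinkT)
  evac-weight : ∀ w → countEntries (between 1 w) Y ≡ sum (take w (reverse α))
  evac-weight w = begin
    countEntries (between 1 w) Y ≡⟨ countEntries-EVAC (between 1 w) refl n T ⟩
    countEntries (λ x → between 1 w (suc n ∸ x)) T ≡⟨ cong (countEntries (λ x → between 1 w (suc n ∸ x))) sink≡shiftedSource ⟩
    count (λ x → between 1 w (suc n ∸ x)) (concat (map (map shift) S)) ≡⟨ cong (count (λ x → between 1 w (suc n ∸ x))) (concat-map S) ⟩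
    count (λ x → between 1 w (suc n ∸ x)) (map shift (concat S)) ≡⟨ count-map _ shift (concat S) ⟩
    count (λ s → between 1 w (suc n ∸ shift s)) (concat S) ≡⟨ count-concat-oneTo _ ⟩
    count (λ s → between 1 w (suc n ∸ shift s)) (oneTo m) ≡⟨ count-ext∈ _ _ (oneTo m) evac-shift ⟩
    count (λ s → (L ∸ w) <ᵇ label α s) (oneTo m) ≡⟨ cong (λ k → count (λ s → (L ∸ w) <ᵇ label α s) (oneTo k)) (sym sum-α) ⟩
    count (λ s → (L ∸ w) <ᵇ label α s) (oneTo (sum α)) ≡⟨ count-label> (L ∸ w) α ⟩
    sum (drop (L ∸ w) α) ≡⟨ sym (sum-take-reverse α w) ⟩
    sum (take w (reverse α)) ∎
    where
    open ≡-Reasoning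
    evac-shift : ∀ s → s ∈ oneTo m → between 1 w (suc n ∸ shift s) ≡ ((L ∸ w) <ᵇ label α s)
    evac-shift s mem = between-1-evac n L (label α s) w hL (label≥1 α s) (label-α≤length s (proj₁ r) (proj₂ r))
      where r = All.lookup (oneTo-range m) mem

mainTheorem12 : (la : List ℕ) (n : ℕ) (S S' : Tableau) →
  1 ≤ n → Partition la →
  IsStandard S → shape S ≡ la →
  length (desComp S) ≤ n →
  IsStandard S' → shape S' ≡ la →
  (∀ T → InV n S T → InV n S' (EVAC n T)) →
  (∀ T' → InV n S' T' → ∃ λ T → InV n S T × EVAC n T ≡ T') →
  IsSink n S' (EVAC n (Tα (desComp S) S))
  × (∀ T → IsSink n S T → EVAC n T ≡ Tα (reverse (desComp S)) S')
mainTheorem12 la n S S' _ _ stdS _ hL _ _ evac-V evac-V⁻ =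
  evac-source-isSink n S S' stdS hL evac-V evac-V⁻ , evac-sink≡source n S S' stdS hL evac-V
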